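{- Let $G$ be a finite connected multigraph with root $q$ and let $\Sigma$ be any tree growing sequence for $G$. If $f\in\mathcal{P}_{G,q}$, then the monomial $x^\alpha y^\beta$ output by the TGS algorithm with $\Sigma$ applied to $f$ is a monomial occurring (with positive coefficient) in the Tutte polynomial $T(G;x,y)$, i.e. an element of the multiset $\mathcal{M}_G$.
   Context: $G=(V,E)$ is a finite connected multigraph (loops and multiple edges allowed), $V=\{q,v_1,\dots,v_n\}$ with root $q$; parallel edges are given a fixed order. For $A\subseteq V\setminus\{q\}$ and $v\in A$, $outdeg_A(v)$ is the number of edges, with multiplicity, joining $v$ to vertices not in $A$. A $G$-parking function is $f:V\setminus\{q\}\to\mathbb{Z}_{\ge 0}$ such that every nonempty $A\subseteq V\setminus\{q\}$ contains $v$ with $0\le f(v)<outdeg_A(v)$; $\mathcal{P}_{G,q}$ is their set. $T(G;x,y)$ is the Tutte polynomial, $T(G;x,y)=\sum_{A\subseteq E}(x-1)^{c(A)-c(G)}(y-1)^{|A|+c(A)-|V|}$ with $c(\cdot)$ the number of connected components of the spanning subgraph; $\mathcal{M}_G$ is the multiset of its monomials, each monomial appearing as many times as its coefficient. A rooted tree in $S\subseteq E$ is a tree subgraph containing $q$ with edges in $S$ (including $\{q\}$). A tree growing sequence $\Sigma=\{(S,\sigma_S)\}$ assigns to every $S\subseteq E$ and every rooted tree $T$ in $S$ an edge $\sigma_S(T)\in S\setminus E(T)$ with an endpoint in $V(T)$, whenever such an edge exists (and is undefined otherwise). The TGS algorithm applied to $f$ maintains $S$ (initially $E$), a tree $T=(U,X)$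 (initially $(\{q\},\emptyset)$), integers $\alpha,\beta$ (initially $0$) and a working copy of $f$. While $e=\sigma_S(T)$ is defined, with $e_t\in U$ an endpoint and $e_h$ the other endpoint: if $e_h\in U$, remove $e$ from $S$ and increase $\beta$ by $1$; otherwise if $f(e_h)<0$ terminate; if $f(e_h)=0$, add $e$ to $X$ and $e_h$ to $U$, increasing $\alpha$ by $1$ if $e$ is a bridge of $(V,S)$; if $f(e_h)\ge1$, decrease $f(e_h)$ by $1$ and remove $e$ from $S$. Output: $T_f=(U,X)$ and $x^\alpha y^\beta$. -}

module Defs where

open import Data.Nat using (ℕ; zero; suc; _+_; _∸_; _<_)
open import Data.Integer as ℤ using (ℤ; +_; -[1+_])
open import Data.Fin using (Fin; _≟_)
open import Data.Fin.Subset using (Subset; _∈_; _∉_; _⊆_; ⊤; ⁅_⁆; _∪_; _-_; ∣_∣; Nonempty)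
open import Data.Vec using (Vec; []; _∷_; lookup)
open import Data.Bool using (Bool; true; false; if_then_else_; _∧_; _∨_; not)
open import Data.List using (List; []; _∷_; map; _++_; allFin)
open import Data.Nat.ListAction using (sum)
open import Data.Product using (_×_; _,_; proj₁; proj₂; Σ; ∃; ∃-syntax)
open import Data.Sum using (_⊎_)
open import Data.Maybe using (Maybe; just; nothing)
open import Relation.Nullary using (¬_; yes; no)
open import Relation.Nullary.Decidable using (⌊_⌋)
open import Relation.Binary.PropositionalEquality using (_≡_)
open import Function using (_⇔_)

-- Vertices are Fin N, edges are Fin m (this fixes
-- the order of parallel edges); each edge has an (unordered) pair of
-- endpoints, given as an ordered pair whose order is irrelevant.
-- Loops (ends e = (v , v)) and parallel edges are allowed.

record Multigraph : Set where
  field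
    N    : ℕ
    m    : ℕ
    ends : Fin m → Fin N × Fin N
    q    : Fin N

module _ (G : Multigraph) where
  open Multigraph G

  end₁ end₂ : Fin m → Fin N
  end₁ e = proj₁ (ends e)
  end₂ e = proj₂ (ends e)

  Adj : Subset m → Fin m → Fin N → Fin N → Set
  Adj S e x y = e ∈ S × ((end₁ e ≡ x × end₂ e ≡ y) ⊎ (end₂ e ≡ x × end₁ e ≡ y))

  data Path (S : Subset m) : Fin N → Fin N → Set where
    nil  : ∀ {u} → Path S u u
    cons : ∀ {u w v} (e : Fin m) → Adj S e u w → Path S w v → Path S u v

  Connected : Set
  Connected = ∀ u v → Path ⊤ u v

  -- k is the number of connected components of the spanning subgraph (V , S):
  -- there is a surjective labelling of vertices by Fin k whose fibres are
  -- exactly the connected components.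
  IsNumComponents : Subset m → ℕ → Set
  IsNumComponents S k =
    Σ (Fin N → Fin k) λ comp →
      (∀ (i : Fin k) → ∃[ v ] comp v ≡ i) ×
      (∀ u v → (comp u ≡ comp v) ⇔ Path S u v)

  -- e is a bridge of (V , S): e ∈ S and deleting e disconnects its endpoints
  -- (i.e. deleting e increases the number of components)
  IsBridge : Subset m → Fin m → Set
  IsBridge S e = e ∈ S × ¬ Path (S - e) (end₁ e) (end₂ e)

  -- G-parking functions.  f is given on all vertices; its value at the
  -- root q is irrelevant (never used), so f represents a function on V∖{q}.

  outdeg : Subset N → Fin N → ℕ
  outdeg A v = sum (map w (allFin m))
    where
    w : Fin m → ℕ
    w e = if (⌊ end₁ e ≟ v ⌋ ∧ not (lookup A (end₂ e)))
             ∨ (⌊ end₂ e ≟ v ⌋ ∧ not (lookup A (end₁ e)))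
          then 1 else 0

  IsParkingFunction : (Fin N → ℕ) → Set
  IsParkingFunction f =
    ∀ (A : Subset N) → q ∉ A → Nonempty A →
      ∃[ v ] (v ∈ A × f v < outdeg A v)

  -- Rooted trees in S: tree subgraphs (U , X) containing q with X ⊆ S.
  -- A tree is a connected graph with |edges| + 1 = |vertices|.

  IsRootedTree : Subset m → Subset N → Subset m → Set
  IsRootedTree S U X =
    X ⊆ S × q ∈ U ×
    (∀ e → e ∈ X → end₁ e ∈ U × end₂ e ∈ U) ×
    (∀ v → v ∈ U → Path X q v) ×
    (∣ X ∣ + 1 ≡ ∣ U ∣)

  Eligible : Subset m → Subset N → Subset m → Fin m → Set
  Eligible S U X e = e ∈ S × e ∉ X × (end₁ e ∈ U ⊎ end₂ e ∈ U)

  -- A tree growing sequence: σ S (U , X) is the chosen edge σ_S(T)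
  -- (nothing = undefined).  Only its values on rooted trees matter.
  record TreeGrowingSequence : Set where
    field
      σ        : Subset m → Subset N → Subset m → Maybe (Fin m)
      σ-just    : ∀ S U X → IsRootedTree S U X →
                  ∀ e → σ S U X ≡ just e → Eligible S U X e
      σ-nothing : ∀ S U X → IsRootedTree S U X →
                  σ S U X ≡ nothing → ∀ e → ¬ Eligible S U X e

  -- The TGS algorithm, as a big-step relation
  --   TGS Σ S U X α β f αₒ βₒ
  -- meaning: started in state (S, T = (U , X), α, β, f) the algorithm
  -- terminates with output monomial x^αₒ y^βₒ.

  Head : Subset N → Fin m → Fin N → Set
  Head U e h = h ∉ U × ((end₁ e ∈ U × end₂ e ≡ h) ⊎ (end₂ e ∈ U × end₁ e ≡ h))

  setAt : (Fin N → ℕ) → Fin N → ℕ → Fin N → ℕ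
  setAt f h k v with v ≟ h
  ... | yes _ = k
  ... | no  _ = f v

  data TGS (Σ' : TreeGrowingSequence) :
           Subset m → Subset N → Subset m → ℕ → ℕ → (Fin N → ℕ) → ℕ → ℕ → Set where
    stop    : ∀ {S U X α β f} →
              TreeGrowingSequence.σ Σ' S U X ≡ nothing →
              TGS Σ' S U X α β f α β
    internal : ∀ {S U X α β f αₒ βₒ e} →
              TreeGrowingSequence.σ Σ' S U X ≡ just e →
              end₁ e ∈ U → end₂ e ∈ U →
              TGS Σ' (S - e) U X α (suc β) f αₒ βₒ →
              TGS Σ' S U X α β f αₒ βₒ
    grow-bridge : ∀ {S U X α β f αₒ βₒ e h} →
              TreeGrowingSequence.σ Σ' S U X ≡ just e →
              Head U e h → f h ≡ 0 → IsBridge S e →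
              TGS Σ' S (U ∪ ⁅ h ⁆) (X ∪ ⁅ e ⁆) (suc α) β f αₒ βₒ →
              TGS Σ' S U X α β f αₒ βₒ
    grow-nonbridge : ∀ {S U X α β f αₒ βₒ e h} →
              TreeGrowingSequence.σ Σ' S U X ≡ just e →
              Head U e h → f h ≡ 0 → ¬ IsBridge S e →
              TGS Σ' S (U ∪ ⁅ h ⁆) (X ∪ ⁅ e ⁆) α β f αₒ βₒ →
              TGS Σ' S U X α β f αₒ βₒ
    decrease : ∀ {S U X α β f αₒ βₒ e h k} →
              TreeGrowingSequence.σ Σ' S U X ≡ just e →
              Head U e h → f h ≡ suc k →
              TGS Σ' (S - e) U X α β (setAt f h k) αₒ βₒ →
              TGS Σ' S U X α β f αₒ βₒ
    -- (the "f(e_h) < 0: terminate" branch cannot occur: the working copy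
    --  stays ℕ-valued, since it is only decremented when ≥ 1)

  TGSOutput : TreeGrowingSequence → (Fin N → ℕ) → ℕ → ℕ → Set
  TGSOutput Σ' f α β = TGS Σ' ⊤ ⁅ q ⁆ Data.Fin.Subset.⊥ 0 0 f α β

-- Bivariate integer polynomials as coefficient functions:
-- p i j = coefficient of x^i y^j.

Poly : Set
Poly = ℕ → ℕ → ℤ

sumTo : ℕ → (ℕ → ℤ) → ℤ
sumTo zero    g = g 0
sumTo (suc n) g = sumTo n g ℤ.+ g (suc n)

_⊕_ : Poly → Poly → Poly
(p ⊕ r) i j = p i j ℤ.+ r i j

_⊗_ : Poly → Poly → Poly
(p ⊗ r) i j = sumTo i λ k → sumTo j λ l → p k l ℤ.* r (i ∸ k) (j ∸ l)

zeroP oneP xP yP : Poly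
zeroP _ _ = + 0
oneP zero zero = + 1
oneP _    _    = + 0
xP (suc zero) zero = + 1
xP _          _    = + 0
yP zero (suc zero) = + 1
yP _    _          = + 0

_⊖_ : Poly → Poly → Poly
(p ⊖ r) i j = p i j ℤ.- r i j

_^ᴾ_ : Poly → ℕ → Poly
p ^ᴾ zero  = oneP
p ^ᴾ suc n = p ⊗ (p ^ᴾ n)

allSubsets : (m : ℕ) → List (Subset m)
allSubsets zero    = [] ∷ []
allSubsets (suc m) = map (true ∷_) (allSubsets m) ++ map (false ∷_) (allSubsets m)

sumP : List Poly → Poly
sumP []       = zeroP
sumP (p ∷ ps) = p ⊕ sumP ps

-- Tutte polynomial, given the component-count function c (c A = c(A)):
-- T(G;x,y) = Σ_{A ⊆ E} (x-1)^{c(A)-c(G)} (y-1)^{|A|+c(A)-|V|}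
-- (both exponents are nonnegative, so truncated subtraction is exact).
Tutte : (G : Multigraph) → (Subset (Multigraph.m G) → ℕ) → Poly
Tutte G c = sumP (map term (allSubsets m))
  where
  open Multigraph G
  term : Subset m → Poly
  term A = ((xP ⊖ oneP) ^ᴾ (c A ∸ c ⊤)) ⊗ ((yP ⊖ oneP) ^ᴾ (∣ A ∣ + c A ∸ N))

module Submission where

-- For X ⊆ S ⊆ E let T[X,S] be the part of the Tutte expansion
-- over the interval X ⊆ A ⊆ S: Σ (x-1)^{c(A)-1} (y-1)^{|A|+c(A)-|V|}, so
-- T(G) = T[∅,E] for connected G.  Splitting on an edge e ∈ S ∖ X gives
-- T[X,S] = T[X∪e,S] + T[X,S-e]; if X already joins the ends of e this is
-- y·T[X,S-e], if e is a bridge of (V,S) it is x·T[X∪e,S], and T[X,X] = 1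
-- for a spanning tree X.  Every TGS step is one of these cases, so by
-- induction on the run T[X,S] has nonnegative coefficients and a positive
-- one at the monomial still to be output.  The run keeps (V,S) connected,
-- T = (U,X) a rooted tree in S, and a parking condition relative to S and
-- V ∖ U; the latter shows that a "decrease" step never deletes a bridge.

open import Defs
open import Data.Nat using (ℕ)
open import Data.Integer using (+_; _<_)
open import Data.Fin using (Fin)
open import Data.Fin.Subset using (Subset)

open import Data.Nat as ℕ using (zero; suc; _+_; _∸_; _≤_)
import Data.Nat.Properties as ℕP
open import Data.Nat.ListAction using (sum)
open import Data.Nat.Tactic.RingSolver using () renaming (solve-∀ to solveℕ-∀)
open import Data.Integer as ℤ using (ℤ; -[1+_])
import Data.Integer.Properties as ℤP
open import Data.Integer.Tactic.RingSolver using (solve-∀)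
open import Data.Fin using (zero; suc; _≟_)
open import Data.Fin.Properties using (injective⇒≤; suc-injective)
open import Data.Fin.Subset using (⁅_⁆; _∪_; _-_; _─_; ⊤; ⊥; _∈_; _∉_; _⊆_; ∣_∣; Nonempty)
open import Data.Fin.Subset.Properties
  using (∪-identityʳ; p─⊥≡p; p⊆p∪q; q⊆p∪q; x∈p∪q⁻; x∈⁅x⁆; x∈⁅y⁆⇒x≡y; x∈p∧x≢y⇒x∈p-y;
         ∉⊥; ∈⊤; _∈?_; ⊆-antisym; ⊆⊤; ∣⊤∣≡n; drop-there; p⊂q⇒∣p∣<∣q∣; x∈p⇒∣p-x∣<∣p∣;
         ∣⊥∣≡0; ∣⁅x⁆∣≡1)
import Data.Vec
open import Data.Vec using ([]; _∷_; lookup; here; there)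
open import Data.Vec.Properties using ([]=⇒lookup; lookup⇒[]=; lookup∘tabulate; lookup-replicate)
open import Data.Bool using (Bool; true; false; if_then_else_; _∧_; _∨_; not)
open import Data.Bool.Properties using (∧-zeroʳ; ∨-zeroʳ)
open import Data.List using (List; []; _∷_; map; _++_; allFin; tabulate)
import Data.List.Properties as LP
open import Data.Maybe using (just; nothing)
open import Data.Product using (_×_; _,_; proj₁; proj₂; Σ; ∃-syntax; uncurry)
open import Data.Sum using (_⊎_; inj₁; inj₂; [_,_]′)
open import Data.Unit using (tt) renaming (⊤ to Unit)
open import Data.Empty using (⊥-elim) renaming (⊥ to Empty)
open import Function using (_∘_; _⇔_; Equivalence; mk⇔)
open import Relation.Nullary using (¬_; yes; no; Dec)
open import Relation.Nullary.Decidable using (⌊_⌋)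
open import Relation.Binary.PropositionalEquality

-- Coefficients of (x-1)^a (y-1)^b.

shift : (ℕ → ℤ) → ℕ → ℤ
shift F zero    = + 0
shift F (suc k) = F k

mulT-1 : (ℕ → ℤ) → ℕ → ℤ
mulT-1 F k = shift F k ℤ.- F k

powCoeff : ℕ → ℕ → ℤ
powCoeff zero    zero    = + 1
powCoeff zero    (suc k) = + 0
powCoeff (suc a) k       = mulT-1 (powCoeff a) k

sumTo-head : ∀ n (g : ℕ → ℤ) → (∀ k → g (suc k) ≡ + 0) → sumTo n g ≡ g 0
sumTo-head zero    g g≡0 = refl
sumTo-head (suc n) g g≡0 rewrite sumTo-head n g g≡0 | g≡0 n = ℤP.+-identityʳ (g 0)

sumTo-firstTwo : ∀ n (g : ℕ → ℤ) → (∀ k → g (suc (suc k)) ≡ + 0) →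
                 sumTo (suc n) g ≡ g 0 ℤ.+ g 1
sumTo-firstTwo zero    g g≡0 = refl
sumTo-firstTwo (suc n) g g≡0 rewrite sumTo-firstTwo n g g≡0 | g≡0 n = ℤP.+-identityʳ _

sumTo-last : ∀ n (g : ℕ → ℤ) → (∀ k → k ℕ.< n → g k ≡ + 0) → sumTo n g ≡ g n
sumTo-last zero    g g≡0 = refl
sumTo-last (suc n) g g≡0
  rewrite sumTo-last n g (λ k k<n → g≡0 k (ℕP.m<n⇒m<1+n k<n)) | g≡0 n (ℕP.n<1+n n) =
  ℤP.+-identityˡ _

sumTo-cong : ∀ n {g g' : ℕ → ℤ} → (∀ k → g k ≡ g' k) → sumTo n g ≡ sumTo n g'
sumTo-cong zero    g≡g' = g≡g' 0
sumTo-cong (suc n) g≡g' = cong₂ ℤ._+_ (sumTo-cong n g≡g') (g≡g' (suc n))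

x-1 y-1 : Poly
x-1 = xP ⊖ oneP
y-1 = yP ⊖ oneP

x-1-noY : ∀ k l → x-1 k (suc l) ≡ + 0
x-1-noY zero          l = refl
x-1-noY (suc zero)    l = refl
x-1-noY (suc (suc k)) l = refl

y-1-noX : ∀ k l → y-1 (suc k) l ≡ + 0
y-1-noX k zero          = refl
y-1-noX k (suc zero)    = refl
y-1-noX k (suc (suc l)) = refl

shiftX shiftY : Poly → Poly
shiftX P zero    j = + 0
shiftX P (suc i) j = P i j
shiftY P i zero    = + 0
shiftY P i (suc j) = P i j

-- the two surviving terms of a convolution with t-1
minus-one-times : ∀ a b → -[1+ 0 ] ℤ.* a ℤ.+ + 1 ℤ.* b ≡ b ℤ.- a
minus-one-times = solve-∀

*-zero-left : ∀ {a} b → a ≡ + 0 → a ℤ.* b ≡ + 0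
*-zero-left b refl = ℤP.*-zeroˡ b

x-1-times : ∀ P i j → (x-1 ⊗ P) i j ≡ shiftX P i j ℤ.- P i j
x-1-times P i j = trans (sumTo-cong i inner) (outer i)
  where
  inner : ∀ k → sumTo j (λ l → x-1 k l ℤ.* P (i ∸ k) (j ∸ l)) ≡ x-1 k 0 ℤ.* P (i ∸ k) j
  inner k = sumTo-head j _ (λ l → *-zero-left (P (i ∸ k) (j ∸ suc l)) (x-1-noY k l))
  outer : ∀ i → sumTo i (λ k → x-1 k 0 ℤ.* P (i ∸ k) j) ≡ shiftX P i j ℤ.- P i j
  outer zero    = trans (ℤP.-1*i≡-i (P 0 j)) (sym (ℤP.+-identityˡ _))
  outer (suc i) = trans (sumTo-firstTwo i _ (λ k → ℤP.*-zeroˡ (P (i ∸ suc (suc k)) j)))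
                        (minus-one-times (P (suc i) j) (P i j))

y-1-times : ∀ P i j → (y-1 ⊗ P) i j ≡ shiftY P i j ℤ.- P i j
y-1-times P i j = trans (sumTo-head i _ higher) (outer j)
  where
  zeros : ∀ n → sumTo n (λ _ → + 0) ≡ + 0
  zeros zero    = refl
  zeros (suc n) rewrite zeros n = refl
  higher : ∀ k → sumTo j (λ l → y-1 (suc k) l ℤ.* P (i ∸ suc k) (j ∸ l)) ≡ + 0
  higher k = trans (sumTo-cong j (λ l → *-zero-left (P (i ∸ suc k) (j ∸ l)) (y-1-noX k l)))
                   (zeros j)
  outer : ∀ j → sumTo j (λ l → y-1 0 l ℤ.* P i (j ∸ l)) ≡ shiftY P i j ℤ.- P i j
  outer zero    = trans (ℤP.-1*i≡-i (P i 0)) (sym (ℤP.+-identityˡ _))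
  outer (suc j) = trans (sumTo-firstTwo j _ (λ k → ℤP.*-zeroˡ (P i (j ∸ suc (suc k)))))
                        (minus-one-times (P i (suc j)) (P i j))

x-1-pow : ∀ a i → (x-1 ^ᴾ a) i 0 ≡ powCoeff a i
x-1-pow zero    zero    = refl
x-1-pow zero    (suc i) = refl
x-1-pow (suc a) i = trans (x-1-times (x-1 ^ᴾ a) i 0) (cong₂ ℤ._-_ (shifted i) (x-1-pow a i))
  where
  shifted : ∀ i → shiftX (x-1 ^ᴾ a) i 0 ≡ shift (powCoeff a) i
  shifted zero    = refl
  shifted (suc i) = x-1-pow a i

x-1-pow-noY : ∀ a i j → (x-1 ^ᴾ a) i (suc j) ≡ + 0
x-1-pow-noY zero    zero    j = refl
x-1-pow-noY zero    (suc i) j = refl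
x-1-pow-noY (suc a) i j =
  trans (x-1-times (x-1 ^ᴾ a) i (suc j)) (cong₂ ℤ._-_ (shifted i) (x-1-pow-noY a i j))
  where
  shifted : ∀ i → shiftX (x-1 ^ᴾ a) i (suc j) ≡ + 0
  shifted zero    = refl
  shifted (suc i) = x-1-pow-noY a i j

y-1-pow : ∀ b j → (y-1 ^ᴾ b) 0 j ≡ powCoeff b j
y-1-pow zero    zero    = refl
y-1-pow zero    (suc j) = refl
y-1-pow (suc b) j = trans (y-1-times (y-1 ^ᴾ b) 0 j) (cong₂ ℤ._-_ (shifted j) (y-1-pow b j))
  where
  shifted : ∀ j → shiftY (y-1 ^ᴾ b) 0 j ≡ shift (powCoeff b) j
  shifted zero    = refl
  shifted (suc j) = y-1-pow b j

y-1-pow-noX : ∀ b i j → (y-1 ^ᴾ b) (suc i) j ≡ + 0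
y-1-pow-noX zero    i zero    = refl
y-1-pow-noX zero    i (suc j) = refl
y-1-pow-noX (suc b) i j =
  trans (y-1-times (y-1 ^ᴾ b) (suc i) j) (cong₂ ℤ._-_ (shifted j) (y-1-pow-noX b i j))
  where
  shifted : ∀ j → shiftY (y-1 ^ᴾ b) (suc i) j ≡ + 0
  shifted zero    = refl
  shifted (suc j) = y-1-pow-noX b i j

x-1-y-1-coeff : ∀ a b i j → ((x-1 ^ᴾ a) ⊗ (y-1 ^ᴾ b)) i j ≡ powCoeff a i ℤ.* powCoeff b j
x-1-y-1-coeff a b i j =
  trans (sumTo-cong i inner)
    (trans (sumTo-last i _ earlier)
      (cong₂ ℤ._*_ (x-1-pow a i) (trans (cong (λ t → (y-1 ^ᴾ b) t j) (ℕP.n∸n≡0 i)) (y-1-pow b j))))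
  where
  inner : ∀ k → sumTo j (λ l → (x-1 ^ᴾ a) k l ℤ.* (y-1 ^ᴾ b) (i ∸ k) (j ∸ l))
                ≡ (x-1 ^ᴾ a) k 0 ℤ.* (y-1 ^ᴾ b) (i ∸ k) j
  inner k = sumTo-head j _ (λ l → *-zero-left ((y-1 ^ᴾ b) (i ∸ k) (j ∸ suc l)) (x-1-pow-noY a k l))
  earlier : ∀ k → k ℕ.< i → (x-1 ^ᴾ a) k 0 ℤ.* (y-1 ^ᴾ b) (i ∸ k) j ≡ + 0
  earlier k k<i with i ∸ k | ℕP.m>n⇒m∸n≢0 k<i
  ... | zero  | i∸k≢0 = ⊥-elim (i∸k≢0 refl)
  ... | suc t | _     = trans (cong ((x-1 ^ᴾ a) k 0 ℤ.*_) (y-1-pow-noX b t j)) (ℤP.*-zeroʳ ((x-1 ^ᴾ a) k 0))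

*-mulT-1 : ∀ (a : ℤ) (F : ℕ → ℤ) k → a ℤ.* mulT-1 F k ≡ mulT-1 (λ k → a ℤ.* F k) k
*-mulT-1 a F zero    = distrib a (F 0)
  where
  distrib : ∀ a x → a ℤ.* (+ 0 ℤ.- x) ≡ + 0 ℤ.- a ℤ.* x
  distrib = solve-∀
*-mulT-1 a F (suc k) = distrib a (F k) (F (suc k))
  where
  distrib : ∀ a x y → a ℤ.* (x ℤ.- y) ≡ a ℤ.* x ℤ.- a ℤ.* y
  distrib = solve-∀

mulT-1-* : ∀ (a : ℤ) (F : ℕ → ℤ) k → mulT-1 F k ℤ.* a ≡ mulT-1 (λ k → F k ℤ.* a) k
mulT-1-* a F zero    = distrib a (F 0)
  where
  distrib : ∀ a x → (+ 0 ℤ.- x) ℤ.* a ≡ + 0 ℤ.- x ℤ.* a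
  distrib = solve-∀
mulT-1-* a F (suc k) = distrib a (F k) (F (suc k))
  where
  distrib : ∀ a x y → (x ℤ.- y) ℤ.* a ≡ x ℤ.* a ℤ.- y ℤ.* a
  distrib = solve-∀

one-coeff-nonneg : ∀ i j → + 0 ℤ.≤ powCoeff 0 i ℤ.* powCoeff 0 j
one-coeff-nonneg zero    zero    = ℤ.+≤+ ℕ.z≤n
one-coeff-nonneg zero    (suc j) = ℤ.+≤+ ℕ.z≤n
one-coeff-nonneg (suc i) j       = ℤ.+≤+ ℕ.z≤n

-- Sums over all subsets and interval sums.

ΣS : ∀ {m} → (Subset m → ℤ) → ℤ
ΣS {zero}  g = g []
ΣS {suc m} g = ΣS (λ A → g (true ∷ A)) ℤ.+ ΣS (λ A → g (false ∷ A))

sumP-++ : ∀ (ps rs : List Poly) i j → sumP (ps ++ rs) i j ≡ sumP ps i j ℤ.+ sumP rs i j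
sumP-++ []       rs i j = sym (ℤP.+-identityˡ _)
sumP-++ (p ∷ ps) rs i j rewrite sumP-++ ps rs i j = sym (ℤP.+-assoc (p i j) _ _)

sumP-allSubsets : ∀ m (F : Subset m → Poly) i j →
                  sumP (map F (allSubsets m)) i j ≡ ΣS (λ A → F A i j)
sumP-allSubsets zero    F i j = ℤP.+-identityʳ _
sumP-allSubsets (suc m) F i j = begin
  sumP (map F (map (true ∷_) As ++ map (false ∷_) As)) i j
    ≡⟨ cong (λ L → sumP L i j) (LP.map-++ F (map (true ∷_) As) (map (false ∷_) As)) ⟩
  sumP (map F (map (true ∷_) As) ++ map F (map (false ∷_) As)) i j
    ≡⟨ sumP-++ (map F (map (true ∷_) As)) _ i j ⟩
  sumP (map F (map (true ∷_) As)) i j ℤ.+ sumP (map F (map (false ∷_) As)) i j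
    ≡⟨ cong₂ ℤ._+_ (half true) (half false) ⟩
  ΣS (λ A → F (true ∷ A) i j) ℤ.+ ΣS (λ A → F (false ∷ A) i j) ∎
  where
  open ≡-Reasoning
  As = allSubsets m
  half : ∀ b → sumP (map F (map (b ∷_) As)) i j ≡ ΣS (λ A → F (b ∷ A) i j)
  half b = trans (cong (λ L → sumP L i j) (sym (LP.map-∘ As)))
                 (sumP-allSubsets m (λ A → F (b ∷ A)) i j)

ΣS-cong : ∀ {m} {g h : Subset m → ℤ} → (∀ A → g A ≡ h A) → ΣS g ≡ ΣS h
ΣS-cong {zero}  g≡h = g≡h []
ΣS-cong {suc m} g≡h = cong₂ ℤ._+_ (ΣS-cong (λ A → g≡h (true ∷ A))) (ΣS-cong (λ A → g≡h (false ∷ A)))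

ΣS-zero : ∀ m → ΣS {m} (λ _ → + 0) ≡ + 0
ΣS-zero zero = refl
ΣS-zero (suc m) rewrite ΣS-zero m = refl

ΣS-+ : ∀ {m} (g h : Subset m → ℤ) → ΣS (λ A → g A ℤ.+ h A) ≡ ΣS g ℤ.+ ΣS h
ΣS-+ {zero}  g h = refl
ΣS-+ {suc m} g h
  rewrite ΣS-+ (λ A → g (true ∷ A)) (λ A → h (true ∷ A))
        | ΣS-+ (λ A → g (false ∷ A)) (λ A → h (false ∷ A)) =
  interchange (ΣS (λ A → g (true ∷ A))) (ΣS (λ A → h (true ∷ A)))
              (ΣS (λ A → g (false ∷ A))) (ΣS (λ A → h (false ∷ A)))
  where
  interchange : ∀ a b c d → (a ℤ.+ b) ℤ.+ (c ℤ.+ d) ≡ (a ℤ.+ c) ℤ.+ (b ℤ.+ d)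
  interchange = solve-∀

ΣS-- : ∀ {m} (g h : Subset m → ℤ) → ΣS (λ A → g A ℤ.- h A) ≡ ΣS g ℤ.- ΣS h
ΣS-- {zero}  g h = refl
ΣS-- {suc m} g h
  rewrite ΣS-- (λ A → g (true ∷ A)) (λ A → h (true ∷ A))
        | ΣS-- (λ A → g (false ∷ A)) (λ A → h (false ∷ A)) =
  interchange (ΣS (λ A → g (true ∷ A))) (ΣS (λ A → h (true ∷ A)))
              (ΣS (λ A → g (false ∷ A))) (ΣS (λ A → h (false ∷ A)))
  where
  interchange : ∀ a b c d → (a ℤ.- b) ℤ.+ (c ℤ.- d) ≡ (a ℤ.+ c) ℤ.- (b ℤ.+ d)
  interchange = solve-∀

ΣS-mulT-1 : ∀ {m} (W : Subset m → ℕ → ℤ) k →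
            ΣS (λ A → mulT-1 (W A) k) ≡ mulT-1 (λ k → ΣS (λ A → W A k)) k
ΣS-mulT-1 {m} W k = trans (ΣS-- (λ A → shift (W A) k) (λ A → W A k)) (cong (λ z → z ℤ.- ΣS (λ A → W A k)) (shifted k))
  where
  shifted : ∀ k → ΣS (λ A → shift (W A) k) ≡ shift (λ k → ΣS (λ A → W A k)) k
  shifted zero    = ΣS-zero m
  shifted (suc k) = refl

ΣS-single : ∀ {m} (g : Subset m → ℤ) (X : Subset m) → (∀ A → A ≢ X → g A ≡ + 0) → ΣS g ≡ g X
ΣS-single {zero}  g [] _ = refl
ΣS-single {suc m} g (true ∷ X) g≡0 =
  trans (cong₂ ℤ._+_ (ΣS-single (λ A → g (true ∷ A)) X (λ A A≢X → g≡0 _ (A≢X ∘ cong Data.Vec.tail)))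
                     (trans (ΣS-cong (λ A → g≡0 (false ∷ A) λ ())) (ΣS-zero m)))
        (ℤP.+-identityʳ _)
ΣS-single {suc m} g (false ∷ X) g≡0 =
  trans (cong₂ ℤ._+_ (trans (ΣS-cong (λ A → g≡0 (true ∷ A) λ ())) (ΣS-zero m))
                     (ΣS-single (λ A → g (false ∷ A)) X (λ A A≢X → g≡0 _ (A≢X ∘ cong Data.Vec.tail))))
        (ℤP.+-identityˡ _)

ΣS-reindex : ∀ {m} (e : Fin m) (g : Subset m → ℤ) →
  ΣS (λ A → if lookup A e then g A else + 0) ≡ ΣS (λ A → if lookup A e then + 0 else g (A ∪ ⁅ e ⁆))
ΣS-reindex {suc m} zero g = begin
  ΣS (λ A → g (true ∷ A)) ℤ.+ ΣS {m} (λ _ → + 0)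
    ≡⟨ cong (ℤ._+_ (ΣS (λ A → g (true ∷ A)))) (ΣS-zero m) ⟩
  ΣS (λ A → g (true ∷ A)) ℤ.+ + 0
    ≡⟨ ℤP.+-identityʳ _ ⟩
  ΣS (λ A → g (true ∷ A))
    ≡⟨ ΣS-cong (λ A → cong (λ B → g (true ∷ B)) (sym (∪-identityʳ A))) ⟩
  ΣS (λ A → g (true ∷ (A ∪ ⊥)))
    ≡⟨ sym (ℤP.+-identityˡ _) ⟩
  + 0 ℤ.+ ΣS (λ A → g (true ∷ (A ∪ ⊥)))
    ≡⟨ cong (λ z → z ℤ.+ ΣS (λ A → g (true ∷ (A ∪ ⊥)))) (sym (ΣS-zero m)) ⟩
  ΣS {m} (λ _ → + 0) ℤ.+ ΣS (λ A → g (true ∷ (A ∪ ⊥))) ∎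
  where open ≡-Reasoning
ΣS-reindex {suc m} (suc e) g =
  cong₂ ℤ._+_ (ΣS-reindex e (λ A → g (true ∷ A))) (ΣS-reindex e (λ A → g (false ∷ A)))

_⊆ᵇ_ : ∀ {m} → Subset m → Subset m → Bool
[]      ⊆ᵇ []      = true
(x ∷ X) ⊆ᵇ (a ∷ A) = (not x ∨ a) ∧ (X ⊆ᵇ A)

_∈[_,_] : ∀ {m} → Subset m → Subset m → Subset m → Bool
A ∈[ X , S ] = X ⊆ᵇ A ∧ A ⊆ᵇ S

∪⁅⁆-⊆ᵇ : ∀ {m} (e : Fin m) X A → (X ∪ ⁅ e ⁆) ⊆ᵇ A ≡ lookup A e ∧ X ⊆ᵇ A
∪⁅⁆-⊆ᵇ zero (true  ∷ X) (true  ∷ A) rewrite ∪-identityʳ X = refl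
∪⁅⁆-⊆ᵇ zero (true  ∷ X) (false ∷ A) = refl
∪⁅⁆-⊆ᵇ zero (false ∷ X) (true  ∷ A) rewrite ∪-identityʳ X = refl
∪⁅⁆-⊆ᵇ zero (false ∷ X) (false ∷ A) = refl
∪⁅⁆-⊆ᵇ (suc e) (true  ∷ X) (true  ∷ A) = ∪⁅⁆-⊆ᵇ e X A
∪⁅⁆-⊆ᵇ (suc e) (true  ∷ X) (false ∷ A) = sym (∧-zeroʳ (lookup A e))
∪⁅⁆-⊆ᵇ (suc e) (false ∷ X) (a     ∷ A) = ∪⁅⁆-⊆ᵇ e X A

⊆ᵇ-remove : ∀ {m} (e : Fin m) A S → A ⊆ᵇ (S - e) ≡ not (lookup A e) ∧ A ⊆ᵇ S
⊆ᵇ-remove zero (true  ∷ A) (s ∷ S) = refl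
⊆ᵇ-remove zero (false ∷ A) (s ∷ S) = cong (A ⊆ᵇ_) (p─⊥≡p S)
⊆ᵇ-remove (suc e) (true  ∷ A) (true  ∷ S) = ⊆ᵇ-remove e A S
⊆ᵇ-remove (suc e) (true  ∷ A) (false ∷ S) = sym (∧-zeroʳ (not (lookup A e)))
⊆ᵇ-remove (suc e) (false ∷ A) (s     ∷ S) = ⊆ᵇ-remove e A S

⊆ᵇ-∪⁅⁆ : ∀ {m} (e : Fin m) X A → lookup X e ≡ false → X ⊆ᵇ (A ∪ ⁅ e ⁆) ≡ X ⊆ᵇ A
⊆ᵇ-∪⁅⁆ zero    (false ∷ X) (a ∷ A) _ rewrite ∪-identityʳ A = refl
⊆ᵇ-∪⁅⁆ (suc e) (x ∷ X) (true  ∷ A) e∉X rewrite ⊆ᵇ-∪⁅⁆ e X A e∉X = refl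
⊆ᵇ-∪⁅⁆ (suc e) (x ∷ X) (false ∷ A) e∉X rewrite ⊆ᵇ-∪⁅⁆ e X A e∉X = refl

⊆ᵇ⇒⊆ : ∀ {n} (X A : Subset n) → X ⊆ᵇ A ≡ true → X ⊆ A
⊆ᵇ⇒⊆ (true  ∷ X) (true  ∷ A) _   here        = here
⊆ᵇ⇒⊆ (x     ∷ X) (true  ∷ A) X⊆A (there y∈X) = there (⊆ᵇ⇒⊆ X A (tail-⊆ᵇ x X⊆A) y∈X)
  where
  tail-⊆ᵇ : ∀ x {b} → (not x ∨ true) ∧ b ≡ true → b ≡ true
  tail-⊆ᵇ true  b≡true = b≡true
  tail-⊆ᵇ false b≡true = b≡true
⊆ᵇ⇒⊆ (false ∷ X) (false ∷ A) X⊆A (there y∈X) = there (⊆ᵇ⇒⊆ X A X⊆A y∈X)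

⊆⇒⊆ᵇ : ∀ {n} (X A : Subset n) → X ⊆ A → X ⊆ᵇ A ≡ true
⊆⇒⊆ᵇ []          []          _   = refl
⊆⇒⊆ᵇ (true  ∷ X) (true  ∷ A) X⊆A = ⊆⇒⊆ᵇ X A (drop-there ∘ X⊆A ∘ there)
⊆⇒⊆ᵇ (true  ∷ X) (false ∷ A) X⊆A with X⊆A here
... | ()
⊆⇒⊆ᵇ (false ∷ X) (a     ∷ A) X⊆A = ⊆⇒⊆ᵇ X A (drop-there ∘ X⊆A ∘ there)

⊥⊆ᵇ : ∀ {n} (A : Subset n) → ⊥ ⊆ᵇ A ≡ true
⊥⊆ᵇ []      = refl
⊥⊆ᵇ (a ∷ A) = ⊥⊆ᵇ A

⊆ᵇ⊤ : ∀ {n} (A : Subset n) → A ⊆ᵇ ⊤ ≡ true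
⊆ᵇ⊤ []          = refl
⊆ᵇ⊤ (true  ∷ A) = ⊆ᵇ⊤ A
⊆ᵇ⊤ (false ∷ A) = ⊆ᵇ⊤ A

interval : ∀ {m} → (Subset m → ℕ → ℤ) → Subset m → Subset m → ℕ → ℤ
interval T S X k = ΣS (λ A → if A ∈[ X , S ] then T A k else + 0)

avoiding : ∀ {m} → (Subset m → ℕ → ℤ) → Fin m → Subset m → Subset m → ℕ → ℤ
avoiding T e S X k = ΣS (λ A → if lookup A e then + 0 else (if A ∈[ X , S ] then T A k else + 0))

interval-split : ∀ {m} T (e : Fin m) S X k →
                 interval T S X k ≡ interval T S (X ∪ ⁅ e ⁆) k ℤ.+ interval T (S - e) X k
interval-split {m} T e S X k = trans (ΣS-cong termwise) (ΣS-+ {m} _ _)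
  where
  termwise : ∀ A → (if A ∈[ X , S ] then T A k else + 0) ≡
                   (if A ∈[ X ∪ ⁅ e ⁆ , S ] then T A k else + 0) ℤ.+
                   (if A ∈[ X , S - e ] then T A k else + 0)
  termwise A rewrite ∪⁅⁆-⊆ᵇ e X A | ⊆ᵇ-remove e A S with lookup A e | X ⊆ᵇ A | A ⊆ᵇ S
  ... | true  | true  | true  = sym (ℤP.+-identityʳ _)
  ... | true  | true  | false = refl
  ... | true  | false | _     = refl
  ... | false | true  | true  = sym (ℤP.+-identityˡ _)
  ... | false | true  | false = refl
  ... | false | false | _     = refl

interval-delete : ∀ {m} T (e : Fin m) S X k → interval T (S - e) X k ≡ avoiding T e S X k
interval-delete T e S X k = ΣS-cong termwise
  where
  termwise : ∀ A → (if A ∈[ X , S - e ] then T A k else + 0) ≡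
                   (if lookup A e then + 0 else (if A ∈[ X , S ] then T A k else + 0))
  termwise A rewrite ⊆ᵇ-remove e A S with lookup A e | X ⊆ᵇ A
  ... | true  | true  = refl
  ... | true  | false = refl
  ... | false | true  = refl
  ... | false | false = refl

interval-contract : ∀ {m} T (e : Fin m) S X k → lookup S e ≡ true → lookup X e ≡ false →
                    interval T S (X ∪ ⁅ e ⁆) k ≡ avoiding (λ A → T (A ∪ ⁅ e ⁆)) e S X k
interval-contract T e S X k e∈S e∉X =
  trans (ΣS-cong containing) (trans (ΣS-reindex e _) (ΣS-cong reindexed))
  where
  containing : ∀ A → (if A ∈[ X ∪ ⁅ e ⁆ , S ] then T A k else + 0) ≡
                     (if lookup A e then (if A ∈[ X , S ] then T A k else + 0) else + 0)
  containing A rewrite ∪⁅⁆-⊆ᵇ e X A with lookup A e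
  ... | true  = refl
  ... | false = refl
  reindexed : ∀ A →
    (if lookup A e then + 0 else (if (A ∪ ⁅ e ⁆) ∈[ X , S ] then T (A ∪ ⁅ e ⁆) k else + 0)) ≡
    (if lookup A e then + 0 else (if A ∈[ X , S ] then T (A ∪ ⁅ e ⁆) k else + 0))
  reindexed A rewrite ⊆ᵇ-∪⁅⁆ e X A e∉X | ∪⁅⁆-⊆ᵇ e A S | e∈S = refl

avoiding-mulT-1 : ∀ {m} {T₁ T₂ : Subset m → ℕ → ℤ} e S X →
  (∀ A → lookup A e ≡ false → X ⊆ᵇ A ≡ true → A ⊆ᵇ S ≡ true → ∀ k → T₁ A k ≡ mulT-1 (T₂ A) k) →
  ∀ k → avoiding T₁ e S X k ≡ mulT-1 (avoiding T₂ e S X) k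
avoiding-mulT-1 {T₁ = T₁} {T₂} e S X T₁≡ k =
  trans (ΣS-cong termwise) (ΣS-mulT-1 (λ A k → if lookup A e then + 0 else (if A ∈[ X , S ] then T₂ A k else + 0)) k)
  where
  vanishing : ∀ k → mulT-1 (λ _ → + 0) k ≡ + 0
  vanishing zero    = refl
  vanishing (suc k) = refl
  termwise : ∀ A → (if lookup A e then + 0 else (if A ∈[ X , S ] then T₁ A k else + 0)) ≡
                   mulT-1 (λ k → if lookup A e then + 0 else (if A ∈[ X , S ] then T₂ A k else + 0)) k
  termwise A with lookup A e in e∉A | X ⊆ᵇ A in X⊆A | A ⊆ᵇ S in A⊆S
  ... | true  | _     | _     = sym (vanishing k)
  ... | false | true  | true  = T₁≡ A e∉A X⊆A A⊆S k
  ... | false | true  | false = sym (vanishing k)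
  ... | false | false | _     = sym (vanishing k)

shift-cong : ∀ {F G : ℕ → ℤ} → (∀ k → F k ≡ G k) → ∀ k → shift F k ≡ shift G k
shift-cong F≡G zero    = refl
shift-cong F≡G (suc k) = F≡G k

mulT-1-plus : ∀ G k → mulT-1 G k ℤ.+ G k ≡ shift G k
mulT-1-plus G k = cancel (shift G k) (G k)
  where
  cancel : ∀ a b → (a ℤ.- b) ℤ.+ b ≡ a
  cancel = solve-∀

interval-loop : ∀ {m} T (e : Fin m) S X → lookup S e ≡ true → lookup X e ≡ false →
  (∀ A → lookup A e ≡ false → X ⊆ᵇ A ≡ true → A ⊆ᵇ S ≡ true →
     ∀ k → T (A ∪ ⁅ e ⁆) k ≡ mulT-1 (T A) k) →
  ∀ k → interval T S X k ≡ shift (interval T (S - e) X) k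
interval-loop T e S X e∈S e∉X cycle k = begin
  interval T S X k
    ≡⟨ interval-split T e S X k ⟩
  interval T S (X ∪ ⁅ e ⁆) k ℤ.+ interval T (S - e) X k
    ≡⟨ cong₂ ℤ._+_ (trans (interval-contract T e S X k e∈S e∉X) (avoiding-mulT-1 e S X cycle k))
                   (interval-delete T e S X k) ⟩
  mulT-1 (avoiding T e S X) k ℤ.+ avoiding T e S X k
    ≡⟨ mulT-1-plus (avoiding T e S X) k ⟩
  shift (avoiding T e S X) k
    ≡⟨ shift-cong (λ j → sym (interval-delete T e S X j)) k ⟩
  shift (interval T (S - e) X) k ∎
  where open ≡-Reasoning

interval-bridge : ∀ {m} T (e : Fin m) S X → lookup S e ≡ true → lookup X e ≡ false →
  (∀ A → lookup A e ≡ false → X ⊆ᵇ A ≡ true → A ⊆ᵇ S ≡ true →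
     ∀ k → T A k ≡ mulT-1 (λ k → T (A ∪ ⁅ e ⁆) k) k) →
  ∀ k → interval T S X k ≡ shift (interval T S (X ∪ ⁅ e ⁆)) k
interval-bridge {m} T e S X e∈S e∉X bridge k = begin
  interval T S X k
    ≡⟨ interval-split T e S X k ⟩
  interval T S (X ∪ ⁅ e ⁆) k ℤ.+ interval T (S - e) X k
    ≡⟨ ℤP.+-comm (interval T S (X ∪ ⁅ e ⁆) k) (interval T (S - e) X k) ⟩
  interval T (S - e) X k ℤ.+ interval T S (X ∪ ⁅ e ⁆) k
    ≡⟨ cong₂ ℤ._+_ (trans (interval-delete T e S X k) (avoiding-mulT-1 e S X bridge k))
                   (interval-contract T e S X k e∈S e∉X) ⟩
  mulT-1 (avoiding T′ e S X) k ℤ.+ avoiding T′ e S X k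
    ≡⟨ mulT-1-plus (avoiding T′ e S X) k ⟩
  shift (avoiding T′ e S X) k
    ≡⟨ shift-cong (λ j → sym (interval-contract T e S X j e∈S e∉X)) k ⟩
  shift (interval T S (X ∪ ⁅ e ⁆)) k ∎
  where
  open ≡-Reasoning
  T′ : Subset m → ℕ → ℤ
  T′ A = T (A ∪ ⁅ e ⁆)

-- Counting equivalence classes.  A labelling of Fin N by Fin k that is onto
-- and whose fibres are the classes of P certifies that P has k classes;
-- IsNumComponents is the special case P = Path G S.

HasClasses : ∀ {N} → (Fin N → Fin N → Set) → ℕ → Set
HasClasses {N} P k =
  Σ (Fin N → Fin k) λ label →
    (∀ (i : Fin k) → ∃[ v ] label v ≡ i) ×
    (∀ u v → (label u ≡ label v) ⇔ P u v)

module Classes {N} {P : Fin N → Fin N → Set} {k} (cls : HasClasses P k) where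
  label : Fin N → Fin k
  label = proj₁ cls
  rep : Fin k → Fin N
  rep i = proj₁ (proj₁ (proj₂ cls) i)
  label-rep : ∀ i → label (rep i) ≡ i
  label-rep i = proj₂ (proj₁ (proj₂ cls) i)
  related : ∀ {u v} → label u ≡ label v → P u v
  related {u} {v} = Equivalence.to (proj₂ (proj₂ cls) u v)
  sameLabel : ∀ {u v} → P u v → label u ≡ label v
  sameLabel {u} {v} = Equivalence.from (proj₂ (proj₂ cls) u v)

open Classes

classes-antitone : ∀ {N} {P Q : Fin N → Fin N → Set} {k k'} →
  (cP : HasClasses P k) → (cQ : HasClasses Q k') → (∀ u v → Q u v → P u v) → k ≤ k'
classes-antitone cP cQ Q⇒P = injective⇒≤ {f = λ i → label cQ (rep cP i)} injective
  where
  injective : ∀ {i j} → label cQ (rep cP i) ≡ label cQ (rep cP j) → i ≡ j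
  injective {i} {j} same =
    trans (sym (label-rep cP i)) (trans (sameLabel cP (Q⇒P _ _ (related cQ same))) (label-rep cP j))

classes-unique : ∀ {N} {P Q : Fin N → Fin N → Set} {k k'} → HasClasses P k → HasClasses Q k' →
  (∀ u v → Q u v → P u v) → (∀ u v → P u v → Q u v) → k ≡ k'
classes-unique cP cQ Q⇒P P⇒Q = ℕP.≤-antisym (classes-antitone cP cQ Q⇒P) (classes-antitone cQ cP P⇒Q)

-- If every Q-related pair is P-related or passes (for P) through b, then P
-- has at most one class more than Q: send the class of b to a new label.
classes-through-≤ : ∀ {N} {P Q : Fin N → Fin N → Set} {k k'} (a b : Fin N) →
  (cP : HasClasses P k) → (cQ : HasClasses Q k') →
  (∀ u v → Q u v → P u v ⊎ ((P u a × P b v) ⊎ (P u b × P a v))) → k ≤ suc k'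
classes-through-≤ {P = P} {k' = k'} a b cP cQ split = injective⇒≤ {f = f} injective
  where
  f : Fin _ → Fin (suc k')
  f i with label cP (rep cP i) ≟ label cP b
  ... | yes _ = zero
  ... | no _  = suc (label cQ (rep cP i))
  same : ∀ {i j} → P (rep cP i) (rep cP j) → i ≡ j
  same {i} {j} p = trans (sym (label-rep cP i)) (trans (sameLabel cP p) (label-rep cP j))
  injective : ∀ {i j} → f i ≡ f j → i ≡ j
  injective {i} {j} fi≡fj
    with label cP (rep cP i) ≟ label cP b | label cP (rep cP j) ≟ label cP b
  ... | yes i~b | yes j~b = trans (sym (label-rep cP i)) (trans (trans i~b (sym j~b)) (label-rep cP j))
  injective {i} {j} () | yes _ | no _
  injective {i} {j} () | no _  | yes _
  ... | no i≁b | no j≁b with split _ _ (related cQ (suc-injective fi≡fj))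
  ...   | inj₁ p                = same p
  ...   | inj₂ (inj₁ (_ , pbj)) = ⊥-elim (j≁b (sym (sameLabel cP pbj)))
  ...   | inj₂ (inj₂ (pib , _)) = ⊥-elim (i≁b (sameLabel cP pib))

-- If P ⊆ Q and Q joins a to b while P does not, then P has at least one
-- class more than Q: the Q-classes embed avoiding the P-class of b.
classes-join-≥ : ∀ {N} {P Q : Fin N → Fin N → Set} {k k'} (a b : Fin N) →
  (cP : HasClasses P k) → (cQ : HasClasses Q k') →
  (∀ u v → P u v → Q u v) → Q a b → ¬ P a b → suc k' ≤ k
classes-join-≥ {k' = k'} a b cP cQ P⇒Q Qab ¬Pab = injective⇒≤ {f = g} injective
  where
  r : Fin k' → Fin _
  r i with label cP (rep cQ i) ≟ label cP b
  ... | yes _ = a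
  ... | no _  = rep cQ i
  r≁b : ∀ i → label cP (r i) ≢ label cP b
  r≁b i with label cP (rep cQ i) ≟ label cP b
  ... | yes _   = λ a~b → ¬Pab (related cP a~b)
  ... | no  i≁b = i≁b
  label-r : ∀ i → label cQ (r i) ≡ i
  label-r i with label cP (rep cQ i) ≟ label cP b
  ... | yes i~b = trans (sameLabel cQ Qab)
                    (trans (sameLabel cQ (P⇒Q _ _ (related cP (sym i~b)))) (label-rep cQ i))
  ... | no _    = label-rep cQ i
  g : Fin (suc k') → Fin _
  g zero    = label cP b
  g (suc i) = label cP (r i)
  injective : ∀ {i j} → g i ≡ g j → i ≡ j
  injective {zero}  {zero}  _ = refl
  injective {zero}  {suc j} b~j = ⊥-elim (r≁b j (sym b~j))
  injective {suc i} {zero}  i~b = ⊥-elim (r≁b i i~b)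
  injective {suc i} {suc j} i~j =
    cong suc (trans (sym (label-r i)) (trans (sameLabel cQ (P⇒Q _ _ (related cP i~j))) (label-r j)))

classes-suc : ∀ {N} {P Q : Fin N → Fin N → Set} {k k'} (a b : Fin N) →
  HasClasses P k → HasClasses Q k' → (∀ u v → P u v → Q u v) → Q a b → ¬ P a b →
  (∀ u v → Q u v → P u v ⊎ ((P u a × P b v) ⊎ (P u b × P a v))) → k ≡ suc k'
classes-suc a b cP cQ P⇒Q Qab ¬Pab split =
  ℕP.≤-antisym (classes-through-≤ a b cP cQ split) (classes-join-≥ a b cP cQ P⇒Q Qab ¬Pab)

∈⇒lookup : ∀ {n} {x : Fin n} {p} → x ∈ p → lookup p x ≡ true
∈⇒lookup = []=⇒lookup

lookup⇒∈ : ∀ {n} {x : Fin n} {p} → lookup p x ≡ true → x ∈ p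
lookup⇒∈ {x = x} {p} = lookup⇒[]= x p

∉⇒lookup : ∀ {n} {x : Fin n} {p} → x ∉ p → lookup p x ≡ false
∉⇒lookup {x = x} {p} x∉p with lookup p x in eq
... | true  = ⊥-elim (x∉p (lookup⇒∈ eq))
... | false = refl

lookup⇒∉ : ∀ {n} {x : Fin n} {p} → lookup p x ≡ false → x ∉ p
lookup⇒∉ eq x∈p with trans (sym (∈⇒lookup x∈p)) eq
... | ()

∈-remove⁻ : ∀ {n} {x y : Fin n} {p} → x ∈ p - y → x ∈ p × x ≢ y
∈-remove⁻ {x = zero}  {zero}  {s ∷ p} ()
∈-remove⁻ {x = zero}  {suc y} {true ∷ p} here = here , λ ()
∈-remove⁻ {x = suc x} {zero}  {s ∷ p} (there x∈p) = there (subst (x ∈_) (p─⊥≡p p) x∈p) , λ ()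
∈-remove⁻ {x = suc x} {suc y} {s ∷ p} (there x∈p-y) with ∈-remove⁻ {x = x} {y} {p} x∈p-y
... | x∈p , x≢y = there x∈p , x≢y ∘ suc-injective

∈∪⁅⁆⁻ : ∀ {n} {x y : Fin n} {p} → x ∈ p ∪ ⁅ y ⁆ → x ∈ p ⊎ x ≡ y
∈∪⁅⁆⁻ {y = y} {p} x∈ with x∈p∪q⁻ p ⁅ y ⁆ x∈
... | inj₁ x∈p  = inj₁ x∈p
... | inj₂ x∈⁅y⁆ = inj₂ (x∈⁅y⁆⇒x≡y y x∈⁅y⁆)

∈∪⁅⁆ : ∀ {n} {p} (y : Fin n) → y ∈ p ∪ ⁅ y ⁆
∈∪⁅⁆ {p = p} y = q⊆p∪q p ⁅ y ⁆ (x∈⁅x⁆ y)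

card-∪⁅⁆ : ∀ {n} (e : Fin n) A → lookup A e ≡ false → ∣ A ∪ ⁅ e ⁆ ∣ ≡ suc ∣ A ∣
card-∪⁅⁆ zero    (false ∷ A) _ rewrite ∪-identityʳ A = refl
card-∪⁅⁆ (suc e) (true  ∷ A) e∉A = cong suc (card-∪⁅⁆ e A e∉A)
card-∪⁅⁆ (suc e) (false ∷ A) e∉A = card-∪⁅⁆ e A e∉A

card-zero : ∀ {n} (A : Subset n) → ∣ A ∣ ≡ 0 → A ≡ ⊥
card-zero []          _     = refl
card-zero (false ∷ A) empty = cong (false ∷_) (card-zero A empty)

card-nonzero : ∀ {n k} (A : Subset n) → ∣ A ∣ ≡ suc k → ∃[ e ] lookup A e ≡ true
card-nonzero (true  ∷ A) _ = zero , refl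
card-nonzero (false ∷ A) |A|≡1+k with card-nonzero A |A|≡1+k
... | e , e∈A = suc e , e∈A

remove-∪⁅⁆ : ∀ {n} (e : Fin n) A → lookup A e ≡ true → (A - e) ∪ ⁅ e ⁆ ≡ A
remove-∪⁅⁆ zero    (true  ∷ A) _ = cong (true ∷_) (trans (∪-identityʳ (A ─ ⊥)) (p─⊥≡p A))
remove-∪⁅⁆ (suc e) (true  ∷ A) e∈A = cong (true ∷_) (remove-∪⁅⁆ e A e∈A)
remove-∪⁅⁆ (suc e) (false ∷ A) e∈A = cong (false ∷_) (remove-∪⁅⁆ e A e∈A)

lookup-remove : ∀ {n} (e : Fin n) A → lookup (A - e) e ≡ false
lookup-remove zero    (a ∷ A) = refl
lookup-remove (suc e) (a ∷ A) = lookup-remove e A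

module Walks (G : Multigraph) where
  open Multigraph G

  e₁ e₂ : Fin m → Fin N
  e₁ = end₁ G
  e₂ = end₂ G

  Walk : Subset m → Fin N → Fin N → Set
  Walk = Path G

  adj-sym : ∀ {S e x y} → Adj G S e x y → Adj G S e y x
  adj-sym (e∈S , inj₁ (p , q)) = e∈S , inj₂ (q , p)
  adj-sym (e∈S , inj₂ (p , q)) = e∈S , inj₁ (q , p)

  _++ʷ_ : ∀ {S u w v} → Walk S u w → Walk S w v → Walk S u v
  nil           ++ʷ q = q
  cons e adj p  ++ʷ q = cons e adj (p ++ʷ q)

  edgeWalk : ∀ {S e x y} → Adj G S e x y → Walk S x y
  edgeWalk {e = e} adj = cons e adj nil

  reverse : ∀ {S u v} → Walk S u v → Walk S v u
  reverse nil            = nil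
  reverse (cons e adj p) = reverse p ++ʷ edgeWalk (adj-sym adj)

  widen : ∀ {S S' u v} → (∀ {e} → e ∈ S → e ∈ S') → Walk S u v → Walk S' u v
  widen S⊆S' nil                    = nil
  widen S⊆S' (cons e (e∈S , o) p) = cons e (S⊆S' e∈S , o) (widen S⊆S' p)

  endsAdj : ∀ {S} e → e ∈ S → Adj G S e (e₁ e) (e₂ e)
  endsAdj e e∈S = e∈S , inj₁ (refl , refl)

  ThroughEdge : Subset m → Fin m → Fin N → Fin N → Set
  ThroughEdge A e u v =
    Walk A u v ⊎ ((Walk A u (e₁ e) × Walk A (e₂ e) v) ⊎ (Walk A u (e₂ e) × Walk A (e₁ e) v))

  splitWalk : ∀ {A e u v} → Walk (A ∪ ⁅ e ⁆) u v → ThroughEdge A e u v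
  splitWalk nil = inj₁ nil
  splitWalk {A} {e} {u} {v} (cons e' (e'∈ , o) p) with e' ≟ e | splitWalk {A} {e} p
  ... | no e'≢e | rest = prepend rest
    where
    adj : Adj G A e' u _
    adj = [ (λ e'∈A → e'∈A) , (λ e'≡e → ⊥-elim (e'≢e e'≡e)) ]′ (∈∪⁅⁆⁻ e'∈) , o
    prepend : ThroughEdge A e _ v → ThroughEdge A e u v
    prepend (inj₁ q)               = inj₁ (cons e' adj q)
    prepend (inj₂ (inj₁ (x , y))) = inj₂ (inj₁ (cons e' adj x , y))
    prepend (inj₂ (inj₂ (x , y))) = inj₂ (inj₂ (cons e' adj x , y))
  ... | yes refl | rest with o
  ...   | inj₁ (refl , refl) = forwards rest
    where
    forwards : ThroughEdge A e (e₂ e) v → ThroughEdge A e (e₁ e) v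
    forwards (inj₁ q)               = inj₂ (inj₁ (nil , q))
    forwards (inj₂ (inj₁ (_ , y))) = inj₂ (inj₁ (nil , y))
    forwards (inj₂ (inj₂ (_ , y))) = inj₁ y
  ...   | inj₂ (refl , refl) = backwards rest
    where
    backwards : ThroughEdge A e (e₁ e) v → ThroughEdge A e (e₂ e) v
    backwards (inj₁ q)               = inj₂ (inj₂ (nil , q))
    backwards (inj₂ (inj₁ (_ , y))) = inj₁ y
    backwards (inj₂ (inj₂ (_ , y))) = inj₂ (inj₂ (nil , y))

  walk? : ∀ {S k} → IsNumComponents G S k → ∀ u v → Dec (Walk S u v)
  walk? cls u v with label cls u ≟ label cls v
  ... | yes same = yes (related cls same)
  ... | no  diff = no (diff ∘ sameLabel cls)

module Components (G : Multigraph) (c : Subset (Multigraph.m G) → ℕ)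
                  (c-correct : ∀ A → IsNumComponents G A (c A)) where
  open Multigraph G
  open Walks G

  c-positive : ∀ A → 1 ≤ c A
  c-positive A with c A | c-correct A
  ... | zero  | label , _ with label q
  ...   | ()
  c-positive A | suc _ | _ = ℕ.s≤s ℕ.z≤n

  c-connected : ∀ A → (∀ u v → Walk A u v) → c A ≡ 1
  c-connected A connected = classes-unique (c-correct A) one (λ u v _ → connected u v) (λ u v _ → tt)
    where
    one : HasClasses (λ _ _ → Unit) 1
    one = (λ _ → zero) , (λ { zero → q , refl }) , (λ u v → mk⇔ (λ _ → tt) (λ _ → refl))

  c-empty : c ⊥ ≡ N
  c-empty = classes-unique (c-correct ⊥) discrete (λ u v u≡v → subst (Walk ⊥ u) u≡v nil) trivial
    where
    discrete : HasClasses _≡_ N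
    discrete = (λ v → v) , (λ i → i , refl) , (λ u v → mk⇔ (λ e → e) (λ e → e))
    trivial : ∀ u v → Walk ⊥ u v → u ≡ v
    trivial u v nil                    = refl
    trivial u v (cons e (e∈⊥ , _) _) = ⊥-elim (∉⊥ e∈⊥)

  c-add-joined : ∀ e A → Walk A (e₁ e) (e₂ e) → c (A ∪ ⁅ e ⁆) ≡ c A
  c-add-joined e A joined =
    classes-unique (c-correct (A ∪ ⁅ e ⁆)) (c-correct A) (λ u v → widen (p⊆p∪q _)) shortcut
    where
    shortcut : ∀ u v → Walk (A ∪ ⁅ e ⁆) u v → Walk A u v
    shortcut u v p with splitWalk {A} {e} p
    ... | inj₁ p'                = p'
    ... | inj₂ (inj₁ (p₁ , p₂)) = p₁ ++ʷ (joined ++ʷ p₂)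
    ... | inj₂ (inj₂ (p₁ , p₂)) = p₁ ++ʷ (reverse joined ++ʷ p₂)

  c-add-bridge : ∀ e A → ¬ Walk A (e₁ e) (e₂ e) → c A ≡ suc (c (A ∪ ⁅ e ⁆))
  c-add-bridge e A separated =
    classes-suc (e₁ e) (e₂ e) (c-correct A) (c-correct (A ∪ ⁅ e ⁆)) (λ u v → widen (p⊆p∪q _))
      (edgeWalk (endsAdj e (∈∪⁅⁆ e))) separated (λ u v p → splitWalk {A} {e} p)

  c-add-≤ : ∀ e A → c A ≤ suc (c (A ∪ ⁅ e ⁆))
  c-add-≤ e A with walk? (c-correct A) (e₁ e) (e₂ e)
  ... | yes joined    rewrite c-add-joined e A joined = ℕP.n≤1+n _
  ... | no  separated rewrite c-add-bridge e A separated = ℕP.≤-refl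

  -- the nullity |A| + c(A) - |V| is a genuine natural number
  nullity : ∀ A → N ≤ ∣ A ∣ + c A
  nullity A = by-size _ A refl
    where
    by-size : ∀ n A → ∣ A ∣ ≡ n → N ≤ ∣ A ∣ + c A
    by-size zero A empty rewrite card-zero A empty | c-empty = ℕP.m≤n+m N ∣ ⊥ {m} ∣
    by-size (suc n) A |A|≡1+n with card-nonzero A |A|≡1+n
    ... | e , e∈A = subst (λ B → N ≤ ∣ B ∣ + c B) (remove-∪⁅⁆ e A e∈A) step
      where
      A' = A - e
      |A'∪e| : ∣ A' ∪ ⁅ e ⁆ ∣ ≡ suc ∣ A' ∣
      |A'∪e| = card-∪⁅⁆ e A' (lookup-remove e A)
      |A'| : ∣ A' ∣ ≡ n
      |A'| = ℕP.suc-injective (trans (sym |A'∪e|) (trans (cong ∣_∣ (remove-∪⁅⁆ e A e∈A)) |A|≡1+n))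
      step : N ≤ ∣ A' ∪ ⁅ e ⁆ ∣ + c (A' ∪ ⁅ e ⁆)
      step rewrite |A'∪e| = begin
        N                               ≤⟨ by-size n A' |A'| ⟩
        ∣ A' ∣ + c A'                   ≤⟨ ℕP.+-monoʳ-≤ ∣ A' ∣ (c-add-≤ e A') ⟩
        ∣ A' ∣ + suc (c (A' ∪ ⁅ e ⁆))   ≡⟨ ℕP.+-suc ∣ A' ∣ (c (A' ∪ ⁅ e ⁆)) ⟩
        suc (∣ A' ∣) + c (A' ∪ ⁅ e ⁆)   ∎
        where open ℕP.≤-Reasoning

-- Interval sums of the Tutte expansion of a connected graph.

module TutteIntervals (G : Multigraph) (c : Subset (Multigraph.m G) → ℕ)
                      (c-correct : ∀ A → IsNumComponents G A (c A)) where
  open Multigraph G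
  open Walks G
  open Components G c c-correct

  term : Subset m → ℕ → ℕ → ℤ
  term A i j = powCoeff (c A ∸ 1) i ℤ.* powCoeff (∣ A ∣ + c A ∸ N) j

  T[_,_] : Subset m → Subset m → ℕ → ℕ → ℤ
  T[ X , S ] i j = interval (λ A k → term A k j) S X i

  tutte-interval : (∀ u v → Walk ⊤ u v) → ∀ i j → Tutte G c i j ≡ T[ ⊥ , ⊤ ] i j
  tutte-interval connected i j = trans (sumP-allSubsets m _ i j) (ΣS-cong termwise)
    where
    termwise : ∀ A → ((x-1 ^ᴾ (c A ∸ c ⊤)) ⊗ (y-1 ^ᴾ (∣ A ∣ + c A ∸ N))) i j ≡
                     (if A ∈[ ⊥ , ⊤ ] then term A i j else + 0)
    termwise A rewrite x-1-y-1-coeff (c A ∸ c ⊤) (∣ A ∣ + c A ∸ N) i j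
                     | ⊥⊆ᵇ A | ⊆ᵇ⊤ A | c-connected ⊤ connected = refl

  -- adding an edge with joined ends raises the nullity: (y-1)·term
  term-add-joined : ∀ e A → Walk A (e₁ e) (e₂ e) → lookup A e ≡ false →
                    ∀ i k → term (A ∪ ⁅ e ⁆) i k ≡ mulT-1 (term A i) k
  term-add-joined e A joined e∉A i k
    rewrite c-add-joined e A joined | card-∪⁅⁆ e A e∉A | ℕP.+-∸-assoc 1 (nullity A) =
    *-mulT-1 (powCoeff (c A ∸ 1) i) (powCoeff (∣ A ∣ + c A ∸ N)) k

  -- adding a bridge lowers the component count: term = (x-1)·term(A ∪ e)
  term-add-bridge : ∀ e A → ¬ Walk A (e₁ e) (e₂ e) → lookup A e ≡ false →
                    ∀ j k → term A k j ≡ mulT-1 (λ k → term (A ∪ ⁅ e ⁆) k j) k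
  term-add-bridge e A separated e∉A j k
    rewrite c-add-bridge e A separated | card-∪⁅⁆ e A e∉A | ℕP.+-suc ∣ A ∣ (c (A ∪ ⁅ e ⁆))
    with c (A ∪ ⁅ e ⁆) | c-positive (A ∪ ⁅ e ⁆)
  ... | suc c' | _ = mulT-1-* (powCoeff (suc (∣ A ∣ + suc c') ∸ N) j) (powCoeff c') k

  T-split : ∀ S X e i j → T[ X , S ] i j ≡ T[ X ∪ ⁅ e ⁆ , S ] i j ℤ.+ T[ X , S - e ] i j
  T-split S X e i j = interval-split (λ A k → term A k j) e S X i

  T-loop : ∀ S X e → e ∈ S → e ∉ X → Walk X (e₁ e) (e₂ e) →
           ∀ i j → T[ X , S ] i j ≡ shift (λ j → T[ X , S - e ] i j) j
  T-loop S X e e∈S e∉X joined i j =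
    interval-loop (λ A k → term A i k) e S X (∈⇒lookup e∈S) (∉⇒lookup e∉X) cycle j
    where
    cycle : ∀ A → lookup A e ≡ false → X ⊆ᵇ A ≡ true → A ⊆ᵇ S ≡ true →
            ∀ k → term (A ∪ ⁅ e ⁆) i k ≡ mulT-1 (term A i) k
    cycle A e∉A X⊆A _ = term-add-joined e A (widen (⊆ᵇ⇒⊆ X A X⊆A) joined) e∉A i

  T-bridge : ∀ S X e → e ∈ S → e ∉ X → ¬ Walk (S - e) (e₁ e) (e₂ e) →
             ∀ i j → T[ X , S ] i j ≡ shift (λ i → T[ X ∪ ⁅ e ⁆ , S ] i j) i
  T-bridge S X e e∈S e∉X separated i j =
    interval-bridge (λ A k → term A k j) e S X (∈⇒lookup e∈S) (∉⇒lookup e∉X) bridge i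
    where
    A⊆S-e : ∀ A → lookup A e ≡ false → A ⊆ᵇ S ≡ true → A ⊆ S - e
    A⊆S-e A e∉A A⊆S f∈A = x∈p∧x≢y⇒x∈p-y (⊆ᵇ⇒⊆ A S A⊆S f∈A) (λ { refl → lookup⇒∉ e∉A f∈A })
    bridge : ∀ A → lookup A e ≡ false → X ⊆ᵇ A ≡ true → A ⊆ᵇ S ≡ true →
             ∀ k → term A k j ≡ mulT-1 (λ k → term (A ∪ ⁅ e ⁆) k j) k
    bridge A e∉A _ A⊆S = term-add-bridge e A (separated ∘ widen (A⊆S-e A e∉A A⊆S)) e∉A j

  T-tree : ∀ X → (∀ u v → Walk X u v) → ∣ X ∣ + 1 ≡ N →
           ∀ i j → T[ X , X ] i j ≡ powCoeff 0 i ℤ.* powCoeff 0 j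
  T-tree X connected |X|+1≡N i j =
    trans (ΣS-single _ X others) (trans (cong (λ b → if b ∧ b then term X i j else + 0) X⊆X) term-X)
    where
    X⊆X : X ⊆ᵇ X ≡ true
    X⊆X = ⊆⇒⊆ᵇ X X (λ x → x)
    others : ∀ A → A ≢ X → (if A ∈[ X , X ] then term A i j else + 0) ≡ + 0
    others A A≢X with X ⊆ᵇ A in X⊆A | A ⊆ᵇ X in A⊆X
    ... | true  | true  = ⊥-elim (A≢X (⊆-antisym (⊆ᵇ⇒⊆ A X A⊆X) (⊆ᵇ⇒⊆ X A X⊆A)))
    ... | true  | false = refl
    ... | false | _     = refl
    term-X : term X i j ≡ powCoeff 0 i ℤ.* powCoeff 0 j
    term-X rewrite c-connected X connected | |X|+1≡N | ℕP.n∸n≡0 N = refl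

module TreeInvariants (G : Multigraph) where
  open Multigraph G
  open Walks G

  Spanning : Subset m → Set
  Spanning S = ∀ u v → Walk S u v

  Joins : Fin m → Fin N → Fin N → Set
  Joins e t h = (e₁ e ≡ t × e₂ e ≡ h) ⊎ (e₂ e ≡ t × e₁ e ≡ h)

  joins-walk : ∀ {S e t h} → Joins e t h → Walk S t h → Walk S (e₁ e) (e₂ e)
  joins-walk (inj₁ (refl , refl)) p = p
  joins-walk (inj₂ (refl , refl)) p = reverse p

  joins-avoids : ∀ {e t h v} → Joins e t h → t ≢ v → h ≢ v → e₁ e ≢ v × e₂ e ≢ v
  joins-avoids (inj₁ (refl , refl)) t≢v h≢v = t≢v , h≢v
  joins-avoids (inj₂ (refl , refl)) t≢v h≢v = h≢v , t≢v

  tail : ∀ {U e h} → Head G U e h → ∃[ t ] (t ∈ U × Joins e t h)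
  tail (_ , inj₁ (t∈U , refl)) = _ , t∈U , inj₁ (refl , refl)
  tail (_ , inj₂ (t∈U , refl)) = _ , t∈U , inj₂ (refl , refl)

  tree-walk : ∀ {S U X} → IsRootedTree G S U X → ∀ {u v} → u ∈ U → v ∈ U → Walk X u v
  tree-walk (_ , _ , _ , rootWalk , _) u∈U v∈U = reverse (rootWalk _ u∈U) ++ʷ rootWalk _ v∈U

  tree-delete : ∀ {S U X e} → IsRootedTree G S U X → e ∉ X → IsRootedTree G (S - e) U X
  tree-delete (X⊆S , q∈U , endsIn , rootWalk , size) e∉X =
    (λ f∈X → x∈p∧x≢y⇒x∈p-y (X⊆S f∈X) (λ { refl → e∉X f∈X })) , q∈U , endsIn , rootWalk , size

  tree-grow : ∀ {S U X e h} → IsRootedTree G S U X → e ∈ S → e ∉ X → Head G U e h →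
              IsRootedTree G S (U ∪ ⁅ h ⁆) (X ∪ ⁅ e ⁆)
  tree-grow {S} {U} {X} {e} {h} (X⊆S , q∈U , endsIn , rootWalk , size) e∈S e∉X hd@(h∉U , _)
    with tail hd
  ... | t , t∈U , joins = X'⊆S , p⊆p∪q _ q∈U , endsIn' , rootWalk' , size'
    where
    X'⊆S : X ∪ ⁅ e ⁆ ⊆ S
    X'⊆S f∈ with ∈∪⁅⁆⁻ f∈
    ... | inj₁ f∈X  = X⊆S f∈X
    ... | inj₂ refl = e∈S
    ends-e : Joins e t h → e₁ e ∈ U ∪ ⁅ h ⁆ × e₂ e ∈ U ∪ ⁅ h ⁆
    ends-e (inj₁ (refl , refl)) = p⊆p∪q _ t∈U , ∈∪⁅⁆ h
    ends-e (inj₂ (refl , refl)) = ∈∪⁅⁆ h , p⊆p∪q _ t∈U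
    endsIn' : ∀ f → f ∈ X ∪ ⁅ e ⁆ → e₁ f ∈ U ∪ ⁅ h ⁆ × e₂ f ∈ U ∪ ⁅ h ⁆
    endsIn' f f∈ with ∈∪⁅⁆⁻ f∈
    ... | inj₁ f∈X  = p⊆p∪q _ (proj₁ (endsIn f f∈X)) , p⊆p∪q _ (proj₂ (endsIn f f∈X))
    ... | inj₂ refl = ends-e joins
    rootWalk' : ∀ v → v ∈ U ∪ ⁅ h ⁆ → Walk (X ∪ ⁅ e ⁆) q v
    rootWalk' v v∈ with ∈∪⁅⁆⁻ v∈
    ... | inj₁ v∈U  = widen (p⊆p∪q _) (rootWalk v v∈U)
    ... | inj₂ refl = widen (p⊆p∪q _) (rootWalk t t∈U) ++ʷ edgeWalk (∈∪⁅⁆ e , joins)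
    size' : ∣ X ∪ ⁅ e ⁆ ∣ + 1 ≡ ∣ U ∪ ⁅ h ⁆ ∣
    size' rewrite card-∪⁅⁆ e X (∉⇒lookup e∉X) | card-∪⁅⁆ h U (∉⇒lookup h∉U) = cong suc size

  reroute : ∀ {S e u v} → Walk (S - e) (e₁ e) (e₂ e) → Walk S u v → Walk (S - e) u v
  reroute detour nil = nil
  reroute {S} {e} detour (cons f (f∈S , o) p) with f ≟ e
  ... | no f≢e = cons f (x∈p∧x≢y⇒x∈p-y f∈S f≢e , o) (reroute detour p)
  ... | yes refl with o
  ...   | inj₁ (refl , refl) = detour ++ʷ reroute detour p
  ...   | inj₂ (refl , refl) = reverse detour ++ʷ reroute detour p

  spanning-delete : ∀ {S e} → Spanning S → Walk (S - e) (e₁ e) (e₂ e) → Spanning (S - e)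
  spanning-delete spanning detour u v = reroute detour (spanning u v)

  internal-or-head : ∀ {U e} → e₁ e ∈ U ⊎ e₂ e ∈ U → (e₁ e ∈ U × e₂ e ∈ U) ⊎ ∃[ h ] Head G U e h
  internal-or-head {U} {e} touches with e₁ e ∈? U | e₂ e ∈? U
  ... | yes e₁∈U | yes e₂∈U = inj₁ (e₁∈U , e₂∈U)
  ... | yes e₁∈U | no  e₂∉U = inj₂ (e₂ e , e₂∉U , inj₁ (e₁∈U , refl))
  ... | no  e₁∉U | yes e₂∈U = inj₂ (e₁ e , e₁∉U , inj₂ (e₂∈U , refl))
  ... | no  e₁∉U | no  e₂∉U = ⊥-elim ([ e₁∉U , e₂∉U ]′ touches)

  crossing : ∀ {S U u v} → Walk S u v → u ∈ U → v ∉ U →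
             ∃[ e ] (e ∈ S × (e₁ e ∈ U × e₂ e ∉ U ⊎ e₂ e ∈ U × e₁ e ∉ U))
  crossing nil u∈U u∉U = ⊥-elim (u∉U u∈U)
  crossing {U = U} (cons {w = w} e (e∈S , o) p) u∈U v∉U with w ∈? U
  ... | yes w∈U = crossing p w∈U v∉U
  ... | no  w∉U with o
  ...   | inj₁ (refl , refl) = e , e∈S , inj₁ (u∈U , w∉U)
  ...   | inj₂ (refl , refl) = e , e∈S , inj₂ (u∈U , w∉U)

  module Stopping (Σ' : TreeGrowingSequence G) where
    open TreeGrowingSequence Σ'

    stop-spanning : ∀ {S U X} → σ S U X ≡ nothing → IsRootedTree G S U X → Spanning S →
                    (∀ v → v ∈ U) × S ≡ X
    stop-spanning {S} {U} {X} undefined rt@(X⊆S , q∈U , endsIn , _ , _) spanning =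
      all , ⊆-antisym S⊆X X⊆S
      where
      ineligible : ∀ e → ¬ Eligible G S U X e
      ineligible = σ-nothing S U X rt undefined
      all : ∀ v → v ∈ U
      all v with v ∈? U
      ... | yes v∈U = v∈U
      ... | no  v∉U with crossing {U = U} (spanning q v) q∈U v∉U
      ...   | e , e∈S , inj₁ (e₁∈U , e₂∉U) =
              ⊥-elim (ineligible e (e∈S , e₂∉U ∘ proj₂ ∘ endsIn e , inj₁ e₁∈U))
      ...   | e , e∈S , inj₂ (e₂∈U , e₁∉U) =
              ⊥-elim (ineligible e (e∈S , e₁∉U ∘ proj₁ ∘ endsIn e , inj₂ e₂∈U))
      S⊆X : S ⊆ X
      S⊆X {e} e∈S with e ∈? X
      ... | yes e∈X = e∈X
      ... | no  e∉X = ⊥-elim (ineligible e (e∈S , e∉X , inj₁ (all _)))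

sumFin : ∀ n → (Fin n → ℕ) → ℕ
sumFin n w = sum (tabulate w)

sumFin-allFin : ∀ {n} (w : Fin n → ℕ) → sum (map w (allFin n)) ≡ sumFin n w
sumFin-allFin w = cong sum (LP.map-tabulate (λ i → i) w)

sumFin-cong : ∀ n {w w' : Fin n → ℕ} → (∀ i → w i ≡ w' i) → sumFin n w ≡ sumFin n w'
sumFin-cong n w≡w' = cong sum (LP.tabulate-cong w≡w')

sumFin-zero : ∀ n → sumFin n (λ _ → 0) ≡ 0
sumFin-zero zero    = refl
sumFin-zero (suc n) = sumFin-zero n

sumFin-exchange : ∀ n (w w' : Fin n → ℕ) e → (∀ i → i ≢ e → w i ≡ w' i) →
                  sumFin n w + w' e ≡ sumFin n w' + w e
sumFin-exchange (suc n) w w' zero agree =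
  trans (cong (λ s → (w zero + s) + w' zero) (sumFin-cong n (λ i → agree (suc i) λ ())))
        (rearrange (w zero) (sumFin n (λ i → w' (suc i))) (w' zero))
  where
  rearrange : ∀ a b c → (a + b) + c ≡ (c + b) + a
  rearrange = solveℕ-∀
sumFin-exchange (suc n) w w' (suc e) agree = begin
  (w zero + sumFin n (w ∘ suc)) + w' (suc e)   ≡⟨ ℕP.+-assoc (w zero) _ _ ⟩
  w zero + (sumFin n (w ∘ suc) + w' (suc e))   ≡⟨ cong₂ _+_ (agree zero λ ()) rest ⟩
  w' zero + (sumFin n (w' ∘ suc) + w (suc e))  ≡⟨ ℕP.+-assoc (w' zero) _ _ ⟨
  (w' zero + sumFin n (w' ∘ suc)) + w (suc e)  ∎
  where
  open ≡-Reasoning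
  rest = sumFin-exchange n (w ∘ suc) (w' ∘ suc) e (λ i i≢e → agree (suc i) (i≢e ∘ suc-injective))

-- The parking invariant.  It holds initially for a G-parking
-- function, survives every step of the algorithm, and forbids removing a
-- bridge of (V,S) in a "decrease" step.

module Parking (G : Multigraph) (c : Subset (Multigraph.m G) → ℕ)
               (c-correct : ∀ A → IsNumComponents G A (c A)) where
  open Multigraph G
  open Walks G
  open TreeInvariants G

  leaves : Subset N → Fin N → Fin m → Bool
  leaves A v e = (⌊ e₁ e ≟ v ⌋ ∧ not (lookup A (e₂ e))) ∨ (⌊ e₂ e ≟ v ⌋ ∧ not (lookup A (e₁ e)))

  weight : Subset m → Subset N → Fin N → Fin m → ℕ
  weight S A v e = if lookup S e ∧ leaves A v e then 1 else 0

  outdegIn : Subset m → Subset N → Fin N → ℕ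
  outdegIn S A v = sumFin m (weight S A v)

  ParkingIn : Subset m → Subset N → (Fin N → ℕ) → Set
  ParkingIn S U f = ∀ A → (∀ v → v ∈ A → v ∉ U) → Nonempty A →
                    ∃[ v ] (v ∈ A × f v ℕ.< outdegIn S A v)

  weight-≤1 : ∀ S A v e → weight S A v e ≤ 1
  weight-≤1 S A v e with lookup S e ∧ leaves A v e
  ... | true  = ℕP.≤-refl
  ... | false = ℕ.z≤n

  leaves-false : ∀ A v e → (e₁ e ≡ v → e₂ e ∈ A) → (e₂ e ≡ v → e₁ e ∈ A) → leaves A v e ≡ false
  leaves-false A v e at₁ at₂ = cong₂ _∨_ (side (e₁ e) (e₂ e) at₁) (side (e₂ e) (e₁ e) at₂)
    where
    side : ∀ x y → (x ≡ v → y ∈ A) → ⌊ x ≟ v ⌋ ∧ not (lookup A y) ≡ false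
    side x y at with x ≟ v
    ... | no  _   = refl
    ... | yes x≡v rewrite ∈⇒lookup (at x≡v) = refl

  weight-not-leaving : ∀ S A v e → leaves A v e ≡ false → weight S A v e ≡ 0
  weight-not-leaving S A v e stays rewrite stays with lookup S e
  ... | true  = refl
  ... | false = refl

  weight-away : ∀ S A v e → e₁ e ≢ v → e₂ e ≢ v → weight S A v e ≡ 0
  weight-away S A v e e₁≢v e₂≢v =
    weight-not-leaving S A v e (leaves-false A v e (⊥-elim ∘ e₁≢v) (⊥-elim ∘ e₂≢v))

  weight-entering : ∀ {S A v t e} → e ∈ S → Joins e t v → t ∉ A → weight S A v e ≡ 1
  weight-entering {S} {A} {v} {t} {e} e∈S joins t∉A =
    cong (λ b → if b then 1 else 0) (cong₂ _∧_ (∈⇒lookup e∈S) (leaving joins))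
    where
    leaving : Joins e t v → leaves A v e ≡ true
    leaving (inj₁ (refl , refl)) rewrite ∉⇒lookup t∉A with e₂ e ≟ e₂ e
    ... | yes _   = ∨-zeroʳ _
    ... | no  v≢v = ⊥-elim (v≢v refl)
    leaving (inj₂ (refl , refl)) rewrite ∉⇒lookup t∉A with e₁ e ≟ e₁ e
    ... | yes _   = refl
    ... | no  v≢v = ⊥-elim (v≢v refl)

  lookup-remove-other : ∀ {S : Subset m} {e f} → f ≢ e → lookup (S - e) f ≡ lookup S f
  lookup-remove-other {S} {e} {f} f≢e with lookup S f in f∈?S
  ... | true  = ∈⇒lookup {p = S - e} (x∈p∧x≢y⇒x∈p-y (lookup⇒∈ {p = S} f∈?S) f≢e)
  ... | false with lookup (S - e) f in f∈?S-e
  ...   | true  = ⊥-elim (lookup⇒∉ f∈?S (proj₁ (∈-remove⁻ {p = S} (lookup⇒∈ {p = S - e} f∈?S-e))))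
  ...   | false = refl

  outdeg-delete : ∀ S e A v → outdegIn (S - e) A v + weight S A v e ≡ outdegIn S A v
  outdeg-delete S e A v =
    trans (sumFin-exchange m (weight (S - e) A v) (weight S A v) e same-elsewhere)
          (trans (cong (_+_ (outdegIn S A v)) (weight-not-in (lookup-remove e S))) (ℕP.+-identityʳ _))
    where
    same-elsewhere : ∀ f → f ≢ e → weight (S - e) A v f ≡ weight S A v f
    same-elsewhere f f≢e = cong (λ b → if b ∧ leaves A v f then 1 else 0) (lookup-remove-other {S} f≢e)
    weight-not-in : lookup (S - e) e ≡ false → weight (S - e) A v e ≡ 0
    weight-not-in e∉S-e rewrite e∉S-e = refl

  parking-init : ∀ f → IsParkingFunction G f → ParkingIn ⊤ ⁅ q ⁆ f
  parking-init f parking A outside nonempty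
    with parking A (λ q∈A → outside q q∈A (x∈⁅x⁆ q)) nonempty
  ... | v , v∈A , f<outdeg = v , v∈A , subst (f v ℕ.<_) (sym outdeg-all) f<outdeg
    where
    outdeg-all : outdegIn ⊤ A v ≡ outdeg G A v
    outdeg-all = trans (sumFin-cong m λ e → cong (λ b → if b ∧ leaves A v e then 1 else 0)
                                                  (lookup-replicate e true))
                       (sym (sumFin-allFin {m} (λ e → if leaves A v e then 1 else 0)))

  -- growing U only removes candidate sets A
  parking-grow : ∀ {S U f h} → ParkingIn S U f → ParkingIn S (U ∪ ⁅ h ⁆) f
  parking-grow parking A outside = parking A (λ v v∈A v∈U → outside v v∈A (p⊆p∪q _ v∈U))

  -- deleting an edge with both ends in U changes no relevant outdegree
  parking-internal : ∀ {S U f e} → ParkingIn S U f → e₁ e ∈ U → e₂ e ∈ U → ParkingIn (S - e) U f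
  parking-internal {S} {U} {f} {e} parking e₁∈U e₂∈U A outside nonempty
    with parking A outside nonempty
  ... | v , v∈A , f<outdeg = v , v∈A , subst (f v ℕ.<_) (sym unchanged) f<outdeg
    where
    ends-away : ∀ {x} → x ∈ U → x ≢ v
    ends-away x∈U refl = outside _ v∈A x∈U
    unchanged : outdegIn (S - e) A v ≡ outdegIn S A v
    unchanged = trans (sym (ℕP.+-identityʳ _))
                  (trans (cong (_+_ (outdegIn (S - e) A v))
                               (sym (weight-away S A v e (ends-away e₁∈U) (ends-away e₂∈U))))
                         (outdeg-delete S e A v))

  setAt-here : ∀ f h k → setAt G f h k h ≡ k
  setAt-here f h k with h ≟ h
  ... | yes _   = refl
  ... | no  h≢h = ⊥-elim (h≢h refl)

  setAt-elsewhere : ∀ f h k v → v ≢ h → setAt G f h k v ≡ f v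
  setAt-elsewhere f h k v v≢h with v ≟ h
  ... | yes v≡h = ⊥-elim (v≢h v≡h)
  ... | no  _   = refl

  -- a decrease step at the head h keeps the invariant: if the witness is h,
  -- both f(h) and outdeg_A(h) drop by one; otherwise nothing relevant changes
  parking-decrease : ∀ {S U f e h k} → ParkingIn S U f → e ∈ S → Head G U e h → f h ≡ suc k →
                     ParkingIn (S - e) U (setAt G f h k)
  parking-decrease {S} {U} {f} {e} {h} {k} parking e∈S hd f[h]≡1+k A outside nonempty
    with parking A outside nonempty | tail hd
  ... | v , v∈A , f<outdeg | t , t∈U , joins with v ≟ h
  ...   | no v≢h = v , v∈A , subst₂ ℕ._<_ (sym (setAt-elsewhere f h k v v≢h)) (sym unchanged) f<outdeg
    where
    unchanged : outdegIn (S - e) A v ≡ outdegIn S A v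
    unchanged = trans (sym (ℕP.+-identityʳ _))
      (trans (cong (_+_ (outdegIn (S - e) A v))
                   (sym (uncurry (weight-away S A v e)
                                 (joins-avoids joins (λ { refl → outside t v∈A t∈U }) (v≢h ∘ sym)))))
             (outdeg-delete S e A v))
  ...   | yes refl = v , v∈A , subst (ℕ._< outdegIn (S - e) A v) (sym (setAt-here f v k)) k<outdeg
    where
    one-less : suc (outdegIn (S - e) A v) ≡ outdegIn S A v
    one-less = trans (ℕP.+-comm 1 _)
      (trans (cong (_+_ (outdegIn (S - e) A v)) (sym (weight-entering e∈S joins (λ t∈A → outside t t∈A t∈U))))
             (outdeg-delete S e A v))
    k<outdeg : k ℕ.< outdegIn (S - e) A v
    k<outdeg = ℕP.≤-pred (subst (suc (suc k) ≤_) (sym one-less) (subst (ℕ._< outdegIn S A v) f[h]≡1+k f<outdeg))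

  componentOf : ∀ {S k} → IsNumComponents G S k → Fin N → Subset N
  componentOf cls h = Data.Vec.tabulate (λ v → ⌊ label cls v ≟ label cls h ⌋)

  ∈-component⁻ : ∀ {S k} (cls : IsNumComponents G S k) {h v} → v ∈ componentOf cls h → Walk S v h
  ∈-component⁻ cls {h} {v} v∈ with label cls v ≟ label cls h
                                  | trans (sym (lookup∘tabulate (λ v → ⌊ label cls v ≟ label cls h ⌋) v))
                                          (∈⇒lookup v∈)
  ... | yes same | _ = related cls same

  ∈-component⁺ : ∀ {S k} (cls : IsNumComponents G S k) {h v} → Walk S v h → v ∈ componentOf cls h
  ∈-component⁺ cls {h} {v} p =
    lookup⇒∈ (trans (lookup∘tabulate (λ v → ⌊ label cls v ≟ label cls h ⌋) v) decided)
    where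
    decided : ⌊ label cls v ≟ label cls h ⌋ ≡ true
    decided with label cls v ≟ label cls h
    ... | yes _    = refl
    ... | no  diff = ⊥-elim (diff (sameLabel cls p))

  component-outdeg : ∀ S e h v → let A = componentOf (c-correct (S - e)) h in
                     v ∈ A → outdegIn S A v ≡ weight S A v e
  component-outdeg S e h v v∈A =
    trans (sym (ℕP.+-identityʳ _))
      (trans (sumFin-exchange m (weight S A v) (λ _ → 0) e inside)
             (cong (_+ weight S A v e) (sumFin-zero m)))
    where
    cls = c-correct (S - e)
    A = componentOf cls h
    v~h : Walk (S - e) v h
    v~h = ∈-component⁻ cls v∈A
    inside : ∀ f → f ≢ e → weight S A v f ≡ 0
    inside f f≢e with lookup S f in f∈?S
    ... | false = refl
    ... | true  = cong (λ b → if b then 1 else 0) (leaves-false A v f at₁ at₂)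
      where
      f∈S-e : f ∈ S - e
      f∈S-e = x∈p∧x≢y⇒x∈p-y (lookup⇒∈ {p = S} f∈?S) f≢e
      at₁ : e₁ f ≡ v → e₂ f ∈ A
      at₁ refl = ∈-component⁺ cls (reverse (edgeWalk (endsAdj f f∈S-e)) ++ʷ v~h)
      at₂ : e₂ f ≡ v → e₁ f ∈ A
      at₂ refl = ∈-component⁺ cls (edgeWalk (endsAdj f f∈S-e) ++ʷ v~h)

  -- A decrease step never removes a bridge of (V,S).  Otherwise the
  -- component A of the head h in (V, S - e) avoids U, and by the invariant
  -- some v ∈ A has f(v) < outdeg_A(v) ≤ [v = h], contradicting f(h) ≥ 1.
  decrease-not-bridge : ∀ {S U X f e h k} → IsRootedTree G S U X → ParkingIn S U f →
                        e ∈ S → e ∉ X → Head G U e h → f h ≡ suc k → Walk (S - e) (e₁ e) (e₂ e)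
  decrease-not-bridge {S} {U} {X} {f} {e} {h} {k} rt parking e∈S e∉X hd f[h]≡1+k
    with walk? (c-correct (S - e)) (e₁ e) (e₂ e)
  ... | yes joined    = joined
  ... | no  separated with tail hd
  ...   | t , t∈U , joins = ⊥-elim (impossible (parking A outside (h , h∈A)))
    where
    cls = c-correct (S - e)
    A = componentOf cls h
    h∈A : h ∈ A
    h∈A = ∈-component⁺ cls nil
    outside : ∀ v → v ∈ A → v ∉ U
    outside v v∈A v∈U = separated (joins-walk joins
      (widen (proj₁ (tree-delete rt e∉X)) (tree-walk rt t∈U v∈U) ++ʷ ∈-component⁻ cls v∈A))
    impossible : ∃[ v ] (v ∈ A × f v ℕ.< outdegIn S A v) → Empty
    impossible (v , v∈A , f<outdeg) with v ≟ h | subst (f v ℕ.<_) (component-outdeg S e h v v∈A) f<outdeg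
    ... | yes refl | f<weight =
          ℕP.<⇒≱ (subst (ℕ._< weight S A v e) f[h]≡1+k f<weight) (ℕP.≤-trans (weight-≤1 S A v e) (ℕ.s≤s ℕ.z≤n))
    ... | no  v≢h  | f<weight = ℕP.n≮0 (subst (f v ℕ.<_) no-weight f<weight)
      where
      no-weight : weight S A v e ≡ 0
      no-weight = uncurry (weight-away S A v e) (joins-avoids joins (λ { refl → outside t v∈A t∈U }) (v≢h ∘ sym))
  
-- The induction on the run.

module Run (G : Multigraph) (c : Subset (Multigraph.m G) → ℕ)
           (c-correct : ∀ A → IsNumComponents G A (c A)) (Σ' : TreeGrowingSequence G) where
  open Multigraph G
  open Walks G
  open TutteIntervals G c c-correct
  open TreeInvariants G
  open Stopping Σ'
  open Parking G c c-correct
  open TreeGrowingSequence Σ'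

  record Invariant (S : Subset m) (U : Subset N) (X : Subset m) (f : Fin N → ℕ) : Set where
    field
      rooted   : IsRootedTree G S U X
      spanning : Spanning S
      parking  : ParkingIn S U f
  open Invariant

  internal-detour : ∀ {S U X e} → IsRootedTree G S U X → e ∉ X → e₁ e ∈ U → e₂ e ∈ U →
                    Walk (S - e) (e₁ e) (e₂ e)
  internal-detour rt e∉X e₁∈U e₂∈U = widen (proj₁ (tree-delete rt e∉X)) (tree-walk rt e₁∈U e₂∈U)

  -- at the end of a run T[X,S] = 1, since X = S is a spanning tree
  T-stop : ∀ {S U X} → σ S U X ≡ nothing → IsRootedTree G S U X → Spanning S →
           ∀ i j → T[ X , S ] i j ≡ powCoeff 0 i ℤ.* powCoeff 0 j
  T-stop {S} {U} {X} undefined rt spanning i j with stop-spanning undefined rt spanning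
  ... | all , refl = T-tree X (λ u v → tree-walk rt (all u) (all v)) size i j
    where
    size : ∣ X ∣ + 1 ≡ N
    size = trans (proj₂ (proj₂ (proj₂ (proj₂ rt))))
                 (trans (cong ∣_∣ (⊆-antisym ⊆⊤ (λ {x} _ → all x))) (∣⊤∣≡n N))

  shift-nonneg : ∀ (F : ℕ → ℤ) → (∀ k → + 0 ℤ.≤ F k) → ∀ k → + 0 ℤ.≤ shift F k
  shift-nonneg F F≥0 zero    = ℤ.+≤+ ℕ.z≤n
  shift-nonneg F F≥0 (suc k) = F≥0 k

  -- both kinds of step decrease |S ∖ X|, measured as n with |S| ≤ n + |X|
  size-delete : ∀ {S X : Subset m} {e n} → e ∈ S → ∣ S ∣ ≤ suc n + ∣ X ∣ → ∣ S - e ∣ ≤ n + ∣ X ∣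
  size-delete e∈S size = ℕP.≤-pred (ℕP.≤-trans (x∈p⇒∣p-x∣<∣p∣ e∈S) size)

  size-grow : ∀ {S X : Subset m} {e n} → e ∉ X → ∣ S ∣ ≤ suc n + ∣ X ∣ → ∣ S ∣ ≤ n + ∣ X ∪ ⁅ e ⁆ ∣
  size-grow {X = X} {e} {n} e∉X size rewrite card-∪⁅⁆ e X (∉⇒lookup e∉X) | ℕP.+-suc n ∣ X ∣ = size

  -- T[X,S] has nonnegative coefficients whenever X is a rooted tree in the
  -- connected (V,S): follow the algorithm's case analysis on the chosen
  -- edge, by induction on |S ∖ X|
  T-nonneg : ∀ S U X → IsRootedTree G S U X → Spanning S → ∀ i j → + 0 ℤ.≤ T[ X , S ] i j
  T-nonneg S U X rt spanning = by-size ∣ S ∣ S U X (ℕP.m≤m+n _ _) rt spanning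
    where
    by-size : ∀ n S U X → ∣ S ∣ ≤ n + ∣ X ∣ → IsRootedTree G S U X → Spanning S →
              ∀ i j → + 0 ℤ.≤ T[ X , S ] i j
    by-size n S U X size rt spanning i j with σ S U X in chosen
    ... | nothing rewrite T-stop chosen rt spanning i j = one-coeff-nonneg i j
    ... | just e with σ-just S U X rt e chosen
    ...   | e∈S , e∉X , touches with n
    ...     | zero   = ⊥-elim (ℕP.<⇒≱ (p⊂q⇒∣p∣<∣q∣ (proj₁ rt , _ , e∈S , e∉X)) size)
    ...     | suc n' with internal-or-head touches
    ...       | inj₁ (e₁∈U , e₂∈U) rewrite T-loop S X e e∈S e∉X (tree-walk rt e₁∈U e₂∈U) i j =
                shift-nonneg _ (λ j → by-size n' (S - e) U X (size-delete {X = X} e∈S size) (tree-delete rt e∉X)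
                  (spanning-delete spanning (internal-detour rt e∉X e₁∈U e₂∈U)) i j) j
    ...       | inj₂ (h , hd) with walk? (c-correct (S - e)) (e₁ e) (e₂ e)
    ...         | no separated rewrite T-bridge S X e e∈S e∉X separated i j =
                shift-nonneg _ (λ i → by-size n' S (U ∪ ⁅ h ⁆) (X ∪ ⁅ e ⁆) (size-grow {S = S} e∉X size)
                  (tree-grow rt e∈S e∉X hd) spanning i j) i
    ...         | yes detour rewrite T-split S X e i j =
                ℤP.+-mono-≤
                  (by-size n' S (U ∪ ⁅ h ⁆) (X ∪ ⁅ e ⁆) (size-grow {S = S} e∉X size) (tree-grow rt e∈S e∉X hd) spanning i j)
                  (by-size n' (S - e) U X (size-delete {X = X} e∈S size) (tree-delete rt e∉X)
                     (spanning-delete spanning detour) i j)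

  -- the output x^αₒ y^βₒ of a run started with exponents α, β is x^α y^β
  -- times a monomial x^a y^b with positive coefficient in T[X,S]
  record Occurs (S X : Subset m) (α β αₒ βₒ : ℕ) : Set where
    constructor occurs
    field
      a b      : ℕ
      αₒ≡      : αₒ ≡ α + a
      βₒ≡      : βₒ ≡ β + b
      positive : + 0 < T[ X , S ] a b

  occurs-loop : ∀ {S X e α β αₒ βₒ} → e ∈ S → e ∉ X → Walk X (e₁ e) (e₂ e) →
                Occurs (S - e) X α (suc β) αₒ βₒ → Occurs S X α β αₒ βₒ
  occurs-loop {S} {X} {e} {β = β} e∈S e∉X joined (occurs a b αₒ≡ βₒ≡ positive) =
    occurs a (suc b) αₒ≡ (trans βₒ≡ (sym (ℕP.+-suc β b)))
      (subst (+ 0 <_) (sym (T-loop S X e e∈S e∉X joined a (suc b))) positive)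

  occurs-bridge : ∀ {S X e α β αₒ βₒ} → e ∈ S → e ∉ X → ¬ Walk (S - e) (e₁ e) (e₂ e) →
                  Occurs S (X ∪ ⁅ e ⁆) (suc α) β αₒ βₒ → Occurs S X α β αₒ βₒ
  occurs-bridge {S} {X} {e} {α} e∈S e∉X separated (occurs a b αₒ≡ βₒ≡ positive) =
    occurs (suc a) b (trans αₒ≡ (sym (ℕP.+-suc α a))) βₒ≡
      (subst (+ 0 <_) (sym (T-bridge S X e e∈S e∉X separated (suc a) b)) positive)

  occurs-contract : ∀ {S X e α β αₒ βₒ} → (∀ i j → + 0 ℤ.≤ T[ X , S - e ] i j) →
                    Occurs S (X ∪ ⁅ e ⁆) α β αₒ βₒ → Occurs S X α β αₒ βₒ
  occurs-contract {S} {X} {e} rest≥0 (occurs a b αₒ≡ βₒ≡ positive) =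
    occurs a b αₒ≡ βₒ≡ (subst (+ 0 <_) (sym (T-split S X e a b)) (ℤP.+-mono-<-≤ positive (rest≥0 a b)))

  occurs-delete : ∀ {S X e α β αₒ βₒ} → (∀ i j → + 0 ℤ.≤ T[ X ∪ ⁅ e ⁆ , S ] i j) →
                  Occurs (S - e) X α β αₒ βₒ → Occurs S X α β αₒ βₒ
  occurs-delete {S} {X} {e} rest≥0 (occurs a b αₒ≡ βₒ≡ positive) =
    occurs a b αₒ≡ βₒ≡ (subst (+ 0 <_) (sym (T-split S X e a b)) (ℤP.+-mono-≤-< (rest≥0 a b) positive))

  invariant-grow : ∀ {S U X f e h} → Invariant S U X f → e ∈ S → e ∉ X → Head G U e h →
                   Invariant S (U ∪ ⁅ h ⁆) (X ∪ ⁅ e ⁆) f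
  invariant-grow {S} {U} {X} {f} {e} {h} inv e∈S e∉X hd = record
    { rooted   = tree-grow (rooted inv) e∈S e∉X hd
    ; spanning = spanning inv
    ; parking  = parking-grow {S} {U} {f} {h} (parking inv) }

  invariant-delete : ∀ {S U X f f' e} → Invariant S U X f → e ∉ X → Walk (S - e) (e₁ e) (e₂ e) →
                     ParkingIn (S - e) U f' → Invariant (S - e) U X f'
  invariant-delete inv e∉X detour parking' = record
    { rooted   = tree-delete (rooted inv) e∉X
    ; spanning = spanning-delete (spanning inv) detour
    ; parking  = parking' }

  tgs-occurs : ∀ {S U X α β f αₒ βₒ} → TGS G Σ' S U X α β f αₒ βₒ → Invariant S U X f →
               Occurs S X α β αₒ βₒ
  tgs-occurs {α = α} {β} (stop undefined) inv =
    occurs 0 0 (sym (ℕP.+-identityʳ α)) (sym (ℕP.+-identityʳ β))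
      (subst (+ 0 <_) (sym (T-stop undefined (rooted inv) (spanning inv) 0 0)) (ℤ.+<+ (ℕ.s≤s ℕ.z≤n)))
  tgs-occurs {S} {U} {X} {f = f} (internal {e = e} chosen e₁∈U e₂∈U run) inv
    with σ-just S U X (rooted inv) e chosen
  ... | e∈S , e∉X , _ =
    occurs-loop e∈S e∉X (tree-walk (rooted inv) e₁∈U e₂∈U)
      (tgs-occurs run (invariant-delete inv e∉X (internal-detour (rooted inv) e∉X e₁∈U e₂∈U)
                         (parking-internal {S} {U} {f} {e} (parking inv) e₁∈U e₂∈U)))
  tgs-occurs {S} {U} {X} (grow-bridge {e = e} chosen hd _ (_ , separated) run) inv
    with σ-just S U X (rooted inv) e chosen
  ... | e∈S , e∉X , _ = occurs-bridge e∈S e∉X separated (tgs-occurs run (invariant-grow inv e∈S e∉X hd))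
  tgs-occurs {S} {U} {X} (grow-nonbridge {e = e} chosen hd _ not-bridge run) inv
    with σ-just S U X (rooted inv) e chosen
  ... | e∈S , e∉X , _ with walk? (c-correct (S - e)) (e₁ e) (e₂ e)
  ...   | no  separated = ⊥-elim (not-bridge (e∈S , separated))
  ...   | yes detour =
    occurs-contract (T-nonneg (S - e) U X (tree-delete (rooted inv) e∉X) (spanning-delete (spanning inv) detour))
      (tgs-occurs run (invariant-grow inv e∈S e∉X hd))
  tgs-occurs {S} {U} {X} (decrease {e = e} {h = h} chosen hd f[h]≡1+k run) inv
    with σ-just S U X (rooted inv) e chosen
  ... | e∈S , e∉X , _ =
    occurs-delete (T-nonneg S (U ∪ ⁅ h ⁆) (X ∪ ⁅ e ⁆) (tree-grow (rooted inv) e∈S e∉X hd) (spanning inv))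
      (tgs-occurs run (invariant-delete inv e∉X
                         (decrease-not-bridge (rooted inv) (parking inv) e∈S e∉X hd f[h]≡1+k)
                         (parking-decrease (parking inv) e∈S hd f[h]≡1+k)))

  initial : ∀ f → Spanning ⊤ → IsParkingFunction G f → Invariant ⊤ ⁅ q ⁆ ⊥ f
  initial f connected parkingFunction = record
    { rooted   = (λ _ → ∈⊤) , x∈⁅x⁆ q , (λ e e∈⊥ → ⊥-elim (∉⊥ e∈⊥))
               , (λ v v∈⁅q⁆ → subst (Walk ⊥ q) (sym (x∈⁅y⁆⇒x≡y q v∈⁅q⁆)) nil)
               , trans (cong (_+ 1) (∣⊥∣≡0 m)) (sym (∣⁅x⁆∣≡1 q))
    ; spanning = connected
    ; parking  = parking-init f parkingFunction }

proposition2p1p2 :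
    (G : Multigraph) →
    Connected G →
    (c : Subset (Multigraph.m G) → ℕ) →
    (∀ A → IsNumComponents G A (c A)) →
    (Σ' : TreeGrowingSequence G) →
    (f : Fin (Multigraph.N G) → ℕ) →
    IsParkingFunction G f →
    (α β : ℕ) →
    TGSOutput G Σ' f α β →
    + 0 < Tutte G c α β
proposition2p1p2 G connected c c-correct Σ' f parkingFunction α β run =
  occurs-in-tutte (tgs-occurs run (initial f connected parkingFunction))
  where
  open Run G c c-correct Σ'
  open TutteIntervals G c c-correct
  occurs-in-tutte : Occurs ⊤ ⊥ 0 0 α β → + 0 < Tutte G c α β
  occurs-in-tutte (occurs a b refl refl positive) =
    subst (+ 0 <_) (sym (tutte-interval connected a b)) positive
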